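{- For $i=1,2,3$, let $H_i$ be a cubic maximal hypohamiltonian graph (i.e. $H_i$ is not hamiltonian, $H_i+e$ is hamiltonian for every edge $e$ of the complement of $H_i$, and $H_i-v$ is hamiltonian for every vertex $v$) with a vertex $z_i$ whose neighbours are $a_i$, $b_i$, $c_i$, and suppose $H_i$ satisfies the following condition: for every vertex $u_i \notin N_{H_i}(z_i)$ (with $u_i\neq z_i$), the graph $H_i+z_iu_i$ has a hamiltonian cycle containing the edge $a_iz_i$ as well as a hamiltonian cycle not containing $a_iz_i$. Let $F_i=H_i-z_i$ for $i=1,2,3$, and let $G=K_4[H_1,H_2,H_3]$ be the graph obtained from the disjoint union of $F_1,F_2,F_3$ and a new vertex $x$ by adding the edges $xa_1$, $xa_2$, $xa_3$, $b_1c_3$, $b_2c_1$, $b_3c_2$ (an inflated $K_4$, obtained by "opening up" each $H_i$ at $z_i$). Then $G$ is a cubic maximal nontraceable graph, i.e. $G$ is cubic, $G$ has no hamiltonian path, but $G+uv$ has a hamiltonian path for every pair of nonadjacent vertices $u,v$ of $G$.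
   Context: All graphs are simple and finite. A graph is traceable if it has a hamiltonian path; it is maximal nontraceable (MNT) if it is not traceable but adding any missing edge makes it traceable. The vertices $a_i,b_i,c_i$ are called the exit vertices of $F_i$. -}

module Defs where

open import Data.Nat using (ℕ; suc; _≥_)
open import Data.Fin using (Fin; punchIn)
open import Data.List using (List; []; _∷_; _++_; [_]; length)
open import Data.List.Relation.Unary.Linked using (Linked)
open import Data.List.Relation.Unary.Unique.Propositional using (Unique)
open import Data.List.Membership.Propositional using (_∈_)
open import Data.Product using (Σ; ∃; _×_; _,_)
open import Data.Sum using (_⊎_)
open import Data.Empty using (⊥)
open import Relation.Nullary using (¬_)
open import Relation.Binary.PropositionalEquality using (_≡_; _≢_)

Graph : Set → Set₁
Graph V = V → V → Set

IsSimple : {V : Set} → Graph V → Set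
IsSimple {V} G = (∀ u v → G u v → G v u) × (∀ v → ¬ G v v)

addEdge : {V : Set} → Graph V → V → V → Graph V
addEdge G u v x y = G x y ⊎ ((x ≡ u × y ≡ v) ⊎ (x ≡ v × y ≡ u))

-- G - v, for G on Fin (suc n); remaining vertices are Fin n via punchIn v
deleteVertex : {n : ℕ} → Graph (Fin (suc n)) → Fin (suc n) → Graph (Fin n)
deleteVertex G v x y = G (punchIn v x) (punchIn v y)

Cubic : {V : Set} → Graph V → Set
Cubic {V} G = ∀ v → Σ V λ x → Σ V λ y → Σ V λ z →
  (x ≢ y × x ≢ z × y ≢ z) × (G v x × G v y × G v z) ×
  (∀ w → G v w → w ≡ x ⊎ (w ≡ y ⊎ w ≡ z))

record HamPath {V : Set} (G : Graph V) : Set where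
  field
    verts  : List V
    linked : Linked G verts
    unique : Unique verts
    covers : ∀ v → v ∈ verts

Traceable : {V : Set} → Graph V → Set
Traceable G = HamPath G

-- hamiltonian cycle  start ∷ rest  (length ≥ 3), closed walk  start ∷ rest ++ [ start ]
record HamCycle {V : Set} (G : Graph V) : Set where
  field
    start  : V
    rest   : List V
    long   : length rest ≥ 2
    unique : Unique (start ∷ rest)
    covers : ∀ v → v ∈ start ∷ rest
    linked : Linked G (start ∷ rest ++ [ start ])

Hamiltonian : {V : Set} → Graph V → Set
Hamiltonian G = HamCycle G

EdgeOf : {V : Set} {G : Graph V} → HamCycle G → V → V → Set
EdgeOf {V} C u w = Σ (List V) λ ys → Σ (List V) λ zs →
    (HamCycle.start C ∷ HamCycle.rest C ++ [ HamCycle.start C ] ≡ ys ++ u ∷ w ∷ zs)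
  ⊎ (HamCycle.start C ∷ HamCycle.rest C ++ [ HamCycle.start C ] ≡ ys ++ w ∷ u ∷ zs)

MaxHypohamiltonian : {n : ℕ} → Graph (Fin (suc n)) → Set
MaxHypohamiltonian {n} H =
  ¬ Hamiltonian H ×
  (∀ u v → u ≢ v → ¬ H u v → Hamiltonian (addEdge H u v)) ×
  (∀ v → Hamiltonian (deleteVertex H v))

record Rooted : Set₁ where
  field
    m : ℕ
    H : Graph (Fin (suc m))
    z a b c : Fin (suc m)

Good : Rooted → Set
Good R = IsSimple H × Cubic H × MaxHypohamiltonian H ×
  ((a ≢ b × a ≢ c × b ≢ c) × (H z a × H z b × H z c) ×
   (∀ w → H z w → w ≡ a ⊎ (w ≡ b ⊎ w ≡ c))) ×
  (∀ u → u ≢ z → ¬ H z u →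
     (Σ (HamCycle (addEdge H z u)) λ C → EdgeOf C a z) ×
     (Σ (HamCycle (addEdge H z u)) λ C → ¬ EdgeOf C a z))
  where open Rooted R

-- vertices of K4[H1,H2,H3]: x, and the vertices of F_i = H_i - z_i
-- (vertex p : Fin m_i of F_i is vertex punchIn z_i p of H_i)
data KV (R₁ R₂ R₃ : Rooted) : Set where
  xv : KV R₁ R₂ R₃
  v₁ : Fin (Rooted.m R₁) → KV R₁ R₂ R₃
  v₂ : Fin (Rooted.m R₂) → KV R₁ R₂ R₃
  v₃ : Fin (Rooted.m R₃) → KV R₁ R₂ R₃

emb : (R : Rooted) → Fin (Rooted.m R) → Fin (suc (Rooted.m R))
emb R p = punchIn (Rooted.z R) p

module _ (R₁ R₂ R₃ : Rooted) where
  private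
    module A = Rooted R₁
    module B = Rooted R₂
    module C = Rooted R₃

  K4 : Graph (KV R₁ R₂ R₃)
  K4 xv xv = ⊥
  K4 xv (v₁ p) = emb R₁ p ≡ A.a
  K4 xv (v₂ p) = emb R₂ p ≡ B.a
  K4 xv (v₃ p) = emb R₃ p ≡ C.a
  K4 (v₁ p) xv = emb R₁ p ≡ A.a
  K4 (v₂ p) xv = emb R₂ p ≡ B.a
  K4 (v₃ p) xv = emb R₃ p ≡ C.a
  K4 (v₁ p) (v₁ q) = A.H (emb R₁ p) (emb R₁ q)
  K4 (v₂ p) (v₂ q) = B.H (emb R₂ p) (emb R₂ q)
  K4 (v₃ p) (v₃ q) = C.H (emb R₃ p) (emb R₃ q)
  K4 (v₁ p) (v₃ q) = emb R₁ p ≡ A.b × emb R₃ q ≡ C.c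
  K4 (v₃ q) (v₁ p) = emb R₁ p ≡ A.b × emb R₃ q ≡ C.c
  K4 (v₂ p) (v₁ q) = emb R₂ p ≡ B.b × emb R₁ q ≡ A.c
  K4 (v₁ q) (v₂ p) = emb R₂ p ≡ B.b × emb R₁ q ≡ A.c
  K4 (v₃ p) (v₂ q) = emb R₃ p ≡ C.b × emb R₂ q ≡ B.c
  K4 (v₂ q) (v₃ p) = emb R₃ p ≡ C.b × emb R₂ q ≡ B.c

MaxNontraceable : {V : Set} → Graph V → Set
MaxNontraceable {V} G =
  ¬ Traceable G × (∀ u v → u ≢ v → ¬ G u v → Traceable (addEdge G u v))

-- Write Fᵢ = Hᵢ − zᵢ. Each Fᵢ is joined to the rest of the graph by exactly one edge at each of its
-- exits aᵢ, bᵢ, cᵢ, the neighbours of zᵢ.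
-- Nontraceable: a hamiltonian path with no end in Fᵢ crosses into Fᵢ only along exit edges, and two
-- visits would need four distinct exits; so it traverses Fᵢ in a single run between two exits, which
-- closes up through zᵢ to a hamiltonian cycle of Hᵢ. Thus every Fᵢ contains an end of the path, which
-- is impossible for three parts and two ends.
-- Maximal: for every missing edge a hamiltonian path is assembled from hamiltonian walks of the Fᵢ,
-- each obtained by opening a hamiltonian cycle at zᵢ: of Hᵢ − zᵢ (a walk from any vertex), of Hᵢ − e
-- for an exit e (between the other two exits), of Hᵢ + pq (between two exits, using pq), and of
-- Hᵢ + zᵢu for a non-exit u (from u to aᵢ, resp. to bᵢ or cᵢ, by the hypothesis on the edge aᵢzᵢ).
-- Cubic: an exit trades its neighbour zᵢ for its unique neighbour outside Fᵢ.
-- Rotating the indices is an isomorphism of the construction, so only F₁ and edges at F₁ are treated.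

module Submission where

open import Data.Empty using (⊥; ⊥-elim)
import Data.Fin as Fin
open import Data.Fin using (Fin; punchIn; punchOut; _≟_)
open import Data.Fin.Properties using (punchIn-injective; punchInᵢ≢i; punchIn-punchOut)
open import Data.List using (List; []; _∷_; _++_; [_]; length; map; reverse)
open import Data.List.Membership.Propositional using (_∈_; _∉_)
open import Data.List.Membership.Propositional.Properties
  using (∈-++⁺ˡ; ∈-++⁺ʳ; ∈-++⁻; ∈-map⁺; ∈-map⁻; ∈-∃++)
open import Data.List.Properties
  using (++-assoc; ++-identityʳ; unfold-reverse; map-++; length-map; length-++-sucʳ; ∷-injectiveʳ)
open import Data.List.Relation.Binary.Disjoint.Propositional using (Disjoint)
open import Data.List.Relation.Unary.All using (All; []; _∷_)
open import Data.List.Relation.Unary.All.Properties.Core using (¬Any⇒All¬)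
open import Data.List.Relation.Unary.AllPairs using ([]; _∷_)
open import Data.List.Relation.Unary.Any using (here; there)
import Data.List.Relation.Unary.Any.Properties as Any
open import Data.List.Relation.Unary.Linked using (Linked; []; [-]; _∷_)
import Data.List.Relation.Unary.Linked.Properties as Linked
open import Data.List.Relation.Unary.Unique.Propositional using (Unique)
open import Data.List.Relation.Unary.Unique.Propositional.Properties
  using (Unique[x∷xs]⇒x∉xs)
  renaming (map⁺ to unique-map⁺; map⁻ to unique-map⁻; ++⁺ to unique-++⁺)
open import Data.Nat using (ℕ; suc; _≤_; _≥_; s≤s; z≤n)
open import Data.Nat.Properties using (≤-trans; ≤-reflexive)
open import Data.Product using (Σ; _×_; _,_; proj₁; proj₂)
open import Data.Sum using (_⊎_; inj₁; inj₂)
open import Data.Unit using (⊤; tt)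
open import Function.Base using (_∘′_)
open import Function.Bundles using (_⇔_; mk⇔; Equivalence)
open import Function.Construct.Composition using (_⇔-∘_)
open import Function.Construct.Identity using (⇔-id)
open import Relation.Nullary using (¬_; Dec; yes; no)
open import Relation.Binary.PropositionalEquality
  using (_≡_; _≢_; refl; sym; trans; cong; subst)

open import Defs

private variable
  V W : Set

lastOf : V → List V → V
lastOf h []       = h
lastOf h (x ∷ xs) = lastOf x xs

lastOf-∈ : ∀ (h : V) xs → lastOf h xs ∈ h ∷ xs
lastOf-∈ h []       = here refl
lastOf-∈ h (x ∷ xs) = there (lastOf-∈ x xs)

lastOf-snoc : ∀ (h : V) xs w → lastOf h (xs ++ [ w ]) ≡ w
lastOf-snoc h []       w = refl
lastOf-snoc h (x ∷ xs) w = lastOf-snoc x xs w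

lastOf-++ : ∀ (h : V) xs y ys → lastOf h (xs ++ y ∷ ys) ≡ lastOf y ys
lastOf-++ h []       y ys = refl
lastOf-++ h (x ∷ xs) y ys = lastOf-++ x xs y ys

lastOf-map : ∀ (f : V → W) h xs → lastOf (f h) (map f xs) ≡ f (lastOf h xs)
lastOf-map f h []       = refl
lastOf-map f h (x ∷ xs) = lastOf-map f x xs

unique-∷ : ∀ {x : V} {xs} → x ∉ xs → Unique xs → Unique (x ∷ xs)
unique-∷ {xs = xs} x∉xs u = ¬Any⇒All¬ xs x∉xs ∷ u

unique-++⁻ : ∀ (xs : List V) {ys} → Unique (xs ++ ys) → Unique xs × Unique ys × Disjoint xs ys
unique-++⁻ []       u = [] , u , λ ()
unique-++⁻ (x ∷ xs) u@(_ ∷ u′) with unique-++⁻ xs u′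
... | uxs , uys , disj =
  unique-∷ (λ x∈xs → x∉ (∈-++⁺ˡ x∈xs)) uxs , uys ,
  λ { (here refl , x∈ys) → x∉ (∈-++⁺ʳ xs x∈ys) ; (there v∈xs , v∈ys) → disj (v∈xs , v∈ys) }
  where
  x∉ : x ∉ xs ++ _
  x∉ = Unique[x∷xs]⇒x∉xs u

unique-swap : ∀ (xs : List V) {ys} → Unique (xs ++ ys) → Unique (ys ++ xs)
unique-swap xs {ys} u with unique-++⁻ xs u
... | uxs , uys , disj = unique-++⁺ uys uxs (λ (v∈ys , v∈xs) → disj (v∈xs , v∈ys))

unique-reverse : ∀ (xs : List V) → Unique xs → Unique (reverse xs)
unique-reverse []       u = u
unique-reverse (x ∷ xs) u@(_ ∷ u′) rewrite unfold-reverse x xs =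
  unique-++⁺ (unique-reverse xs u′) (unique-∷ (λ ()) [])
    λ { (v∈ , here refl) → Unique[x∷xs]⇒x∉xs u (Any.reverse⁻ v∈) }

∈-drop : ∀ {v x : V} xs {ys} → v ≢ x → v ∈ xs ++ x ∷ ys → v ∈ xs ++ ys
∈-drop []       v≢x (here v≡x) = ⊥-elim (v≢x v≡x)
∈-drop []       v≢x (there v∈) = v∈
∈-drop (y ∷ xs) v≢x (here v≡y) = here v≡y
∈-drop (y ∷ xs) v≢x (there v∈) = there (∈-drop xs v≢x v∈)

unique⊆⇒length≤ : ∀ {xs ys : List V} → Unique xs → (∀ {v} → v ∈ xs → v ∈ ys) → length xs ≤ length ys
unique⊆⇒length≤ {xs = []}     _              _   = z≤n
unique⊆⇒length≤ {xs = x ∷ xs} (x≢xs ∷ uxs) xs⊆ys with ∈-∃++ (xs⊆ys (here refl))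
... | ys₁ , ys₂ , refl =
  ≤-trans (s≤s (unique⊆⇒length≤ uxs (λ v∈xs → ∈-drop ys₁ (≢x v∈xs x≢xs) (xs⊆ys (there v∈xs)))))
          (≤-reflexive (sym (length-++-sucʳ ys₁ x ys₂)))
  where
  ≢x : ∀ {v xs} → v ∈ xs → All (x ≢_) xs → v ≢ x
  ≢x (here refl) (x≢v ∷ _) v≡x = x≢v (sym v≡x)
  ≢x (there v∈) (_ ∷ ps)      = ≢x v∈ ps

EachOnce : List V → Set
EachOnce S = Unique S × (∀ v → v ∈ S)

eachOnce-++[] : (S : List V) → EachOnce S → EachOnce (S ++ [])
eachOnce-++[] S = subst EachOnce (sym (++-identityʳ S))

eachOnce-rotate : ∀ (x : V) S → EachOnce (x ∷ S) → EachOnce (S ++ [ x ])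
eachOnce-rotate x S (u , covers) = unique-swap [ x ] u , λ v → move (covers v)
  where
  move : ∀ {v} → v ∈ x ∷ S → v ∈ S ++ [ x ]
  move (here v≡x) = ∈-++⁺ʳ S (here v≡x)
  move (there v∈) = ∈-++⁺ˡ v∈

eachOnce-reverse : ∀ (M : List V) S → EachOnce (M ++ S) → EachOnce (M ++ reverse S)
eachOnce-reverse M S (u , covers) with unique-++⁻ M u
... | uM , uS , disj =
  unique-++⁺ uM (unique-reverse S uS) (λ (v∈M , v∈) → disj (v∈M , Any.reverse⁻ v∈)) ,
  λ v → move (∈-++⁻ M (covers v))
  where
  move : ∀ {v} → v ∈ M ⊎ v ∈ S → v ∈ M ++ reverse S
  move (inj₁ v∈) = ∈-++⁺ˡ v∈
  move (inj₂ v∈) = ∈-++⁺ʳ M (Any.reverse⁺ v∈)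

data Consec {V : Set} (x y : V) : List V → Set where
  here  : ∀ {zs} → Consec x y (x ∷ y ∷ zs)
  there : ∀ {w zs} → Consec x y zs → Consec x y (w ∷ zs)

module _ {x y : V} where

  consec-linked : ∀ {G : Graph V} {xs} → Linked G xs → Consec x y xs → G x y
  consec-linked (r ∷ _) here      = r
  consec-linked (_ ∷ l) (there c) = consec-linked l c

  consec-++ʳ : ∀ xs {ys} → Consec x y ys → Consec x y (xs ++ ys)
  consec-++ʳ []       c = c
  consec-++ʳ (_ ∷ xs) c = there (consec-++ʳ xs c)

  consec-++ˡ : ∀ {xs} ys → Consec x y xs → Consec x y (xs ++ ys)
  consec-++ˡ ys here      = here
  consec-++ˡ ys (there c) = there (consec-++ˡ ys c)

  consec-∈₁ : ∀ {xs} → Consec x y xs → x ∈ xs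
  consec-∈₁ here      = here refl
  consec-∈₁ (there c) = there (consec-∈₁ c)

  consec-∈₂ : ∀ {xs} → Consec x y xs → y ∈ xs
  consec-∈₂ here      = there (here refl)
  consec-∈₂ (there c) = there (consec-∈₂ c)

  consec-snoc⁻ : ∀ h xs {w} → Consec x y (h ∷ xs ++ [ w ]) →
                 Consec x y (h ∷ xs) ⊎ (x ≡ lastOf h xs × y ≡ w)
  consec-snoc⁻ h []       here              = inj₂ (refl , refl)
  consec-snoc⁻ h []       (there (there ()))
  consec-snoc⁻ h (_ ∷ xs) here              = inj₁ here
  consec-snoc⁻ h (x′ ∷ xs) (there c) with consec-snoc⁻ x′ xs c
  ... | inj₁ c′ = inj₁ (there c′)
  ... | inj₂ ends = inj₂ ends

consec-swap : ∀ {x y : V} {xs} → Unique xs → Consec x y xs → Consec y x xs → ⊥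
consec-swap u here      here      = Unique[x∷xs]⇒x∉xs u (here refl)
consec-swap u here      (there c) = Unique[x∷xs]⇒x∉xs u (consec-∈₂ c)
consec-swap u (there c) here      = Unique[x∷xs]⇒x∉xs u (consec-∈₂ c)
consec-swap (_ ∷ u) (there c) (there d) = consec-swap u c d

consec⇒split : ∀ {x y : V} {xs} → Consec x y xs →
               Σ (List V) λ ys → Σ (List V) λ zs → xs ≡ ys ++ x ∷ y ∷ zs
consec⇒split {xs = _ ∷ _ ∷ zs} here = [] , zs , refl
consec⇒split {xs = w ∷ _} (there c) with consec⇒split c
... | ys , zs , eq = w ∷ ys , zs , cong (w ∷_) eq

consec-last : ∀ (h : V) xs ys y → Consec (lastOf h xs) y (h ∷ xs ++ y ∷ ys)
consec-last h []       ys y = here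
consec-last h (x ∷ xs) ys y = there (consec-last x xs ys y)

consec-rotate : ∀ {x y : V} s h r → Consec x y (s ∷ h ∷ r ++ [ s ]) ⇔ Consec x y (h ∷ (r ++ [ s ]) ++ [ h ])
consec-rotate s h r = mk⇔ to from
  where
  to : ∀ {x y} → Consec x y (s ∷ h ∷ r ++ [ s ]) → Consec x y (h ∷ (r ++ [ s ]) ++ [ h ])
  to here      = subst (λ a → Consec a h (h ∷ (r ++ [ s ]) ++ [ h ])) (lastOf-snoc h r s)
                       (consec-last h (r ++ [ s ]) [] h)
  to (there c) = consec-++ˡ [ h ] c
  from : ∀ {x y} → Consec x y (h ∷ (r ++ [ s ]) ++ [ h ]) → Consec x y (s ∷ h ∷ r ++ [ s ])
  from c with consec-snoc⁻ h (r ++ [ s ]) c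
  ... | inj₁ c′ = there c′
  ... | inj₂ (refl , refl) = subst (λ a → Consec a h (s ∷ h ∷ r ++ [ s ])) (sym (lastOf-snoc h r s)) here

addEdge-sym : ∀ {G : Graph V} → (∀ {x y} → G x y → G y x) → ∀ {u v x y} → addEdge G u v x y → addEdge G u v y x
addEdge-sym G-sym (inj₁ r)                   = inj₁ (G-sym r)
addEdge-sym G-sym (inj₂ (inj₁ (x≡u , y≡v))) = inj₂ (inj₂ (y≡v , x≡u))
addEdge-sym G-sym (inj₂ (inj₂ (x≡v , y≡u))) = inj₂ (inj₁ (y≡u , x≡v))

-- Walks

data Walk {V : Set} (G : Graph V) : V → V → List V → Set where
  [_]ʷ : ∀ v → Walk G v v [ v ]
  _∷ʷ_ : ∀ {u v t xs} → G u v → Walk G v t (v ∷ xs) → Walk G u t (u ∷ v ∷ xs)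

infixr 5 _∷ʷ_

module _ {G : Graph V} where

  infixr 5 _⟨_⟩_

  _◅_ : ∀ {u s t xs} → G u s → Walk G s t xs → Walk G u t (u ∷ xs)
  e ◅ [ v ]ʷ    = e ∷ʷ [ v ]ʷ
  e ◅ (r ∷ʷ w) = e ∷ʷ r ∷ʷ w

  _⟨_⟩_ : ∀ {s t u v xs ys} → Walk G s t xs → G t u → Walk G u v ys → Walk G s v (xs ++ ys)
  [ _ ]ʷ   ⟨ e ⟩ w′ = e ◅ w′
  (r ∷ʷ w) ⟨ e ⟩ w′ = r ∷ʷ (w ⟨ e ⟩ w′)

  walk⇒linked : ∀ {s t xs} → Walk G s t xs → Linked G xs
  walk⇒linked [ _ ]ʷ    = [-]
  walk⇒linked (r ∷ʷ w) = r ∷ walk⇒linked w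

  linked⇒walk : ∀ {h xs} → Linked G (h ∷ xs) → Walk G h (lastOf h xs) (h ∷ xs)
  linked⇒walk {h} {[]}    _       = [ h ]ʷ
  linked⇒walk {xs = _ ∷ _} (r ∷ l) = r ∷ʷ linked⇒walk l

  walk-first : ∀ {s t xs} → Walk G s t xs → s ∈ xs
  walk-first [ _ ]ʷ    = here refl
  walk-first (_ ∷ʷ _) = here refl

  walk-unsnoc : ∀ {s t} h xs u → Walk G s t (h ∷ xs ++ [ u ]) →
                Walk G h (lastOf h xs) (h ∷ xs) × G (lastOf h xs) u
  walk-unsnoc h []       u (r ∷ʷ [ _ ]ʷ) = [ h ]ʷ , r
  walk-unsnoc h (x ∷ xs) u (r ∷ʷ w) with walk-unsnoc x xs u w
  ... | w′ , r′ = r ∷ʷ w′ , r′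

  walk-reverse : (∀ {x y} → G x y → G y x) → ∀ {s t xs} → Walk G s t xs → Walk G t s (reverse xs)
  walk-reverse G-sym [ v ]ʷ = [ v ]ʷ
  walk-reverse G-sym {s} (_∷ʷ_ {v = v} {xs = xs} r w) rewrite unfold-reverse s (v ∷ xs) =
    walk-reverse G-sym w ⟨ G-sym r ⟩ [ s ]ʷ

walk-map : ∀ {G : Graph V} {G′ : Graph W} (f : V → W) → (∀ {x y} → G x y → G′ (f x) (f y)) →
           ∀ {s t xs} → Walk G s t xs → Walk G′ (f s) (f t) (map f xs)
walk-map f hom [ v ]ʷ    = [ f v ]ʷ
walk-map f hom (r ∷ʷ w) = hom r ∷ʷ walk-map f hom w

walk-weaken : ∀ {G G′ : Graph V} → (∀ {x y} → G x y → G′ x y) →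
              ∀ {s t xs} → Walk G s t xs → Walk G′ s t xs
walk-weaken sub [ v ]ʷ    = [ v ]ʷ
walk-weaken sub (r ∷ʷ w) = sub r ∷ʷ walk-weaken sub w

walk-unmap : ∀ {G : Graph W} (f : V → W) x xs {a t} → Walk G a t (map f (x ∷ xs)) →
             a ≡ f x × Σ V λ t′ → f t′ ≡ t × Walk (λ u v → G (f u) (f v)) x t′ (x ∷ xs)
walk-unmap f x []       [ _ ]ʷ    = refl , x , refl , [ x ]ʷ
walk-unmap f x (y ∷ xs) (r ∷ʷ w) with walk-unmap f y xs w
... | refl , t′ , t′≡ , w′ = refl , t′ , t′≡ , r ∷ʷ w′

-- Cycles

record Cycle {V : Set} (G : Graph V) : Set where
  field
    start  : V
    rest   : List V
    long   : length rest ≥ 2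
    unique : Unique (start ∷ rest)
    walk   : Walk G start start (start ∷ rest ++ [ start ])

  vertices : List V
  vertices = start ∷ rest

  Edge : V → V → Set
  Edge u w = Consec u w (start ∷ rest ++ [ start ]) ⊎ Consec w u (start ∷ rest ++ [ start ])

module _ {G : Graph V} where

  fromHamCycle : HamCycle G → Cycle G
  fromHamCycle C = record
    { start = start ; rest = rest ; long = long ; unique = unique
    ; walk = subst (λ t → Walk G start t (start ∷ rest ++ [ start ])) (lastOf-snoc start rest start)
                   (linked⇒walk linked) }
    where open HamCycle C

  edgeOf⇒edge : ∀ (C : HamCycle G) {u w} → EdgeOf C u w → Cycle.Edge (fromHamCycle C) u w
  edgeOf⇒edge C (ys , zs , inj₁ eq) = inj₁ (subst (Consec _ _) (sym eq) (consec-++ʳ ys here))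
  edgeOf⇒edge C (ys , zs , inj₂ eq) = inj₂ (subst (Consec _ _) (sym eq) (consec-++ʳ ys here))

  edge⇒edgeOf : ∀ (C : HamCycle G) {u w} → Cycle.Edge (fromHamCycle C) u w → EdgeOf C u w
  edge⇒edgeOf C (inj₁ c) = let ys , zs , eq = consec⇒split c in ys , zs , inj₁ eq
  edge⇒edgeOf C (inj₂ c) = let ys , zs , eq = consec⇒split c in ys , zs , inj₂ eq

  cycle-map : ∀ {G′ : Graph W} (f : V → W) → (∀ {x y} → f x ≡ f y → x ≡ y) →
              (∀ {x y} → G x y → G′ (f x) (f y)) → Cycle G → Cycle G′
  cycle-map {G′ = G′} f f-inj hom C = record
    { start = f start ; rest = map f rest
    ; long = subst (_≥ 2) (sym (length-map f rest)) long
    ; unique = unique-map⁺ f-inj unique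
    ; walk = subst (λ xs → Walk G′ (f start) (f start) (f start ∷ xs)) (map-++ f rest [ start ])
                   (walk-map f hom walk) }
    where open Cycle C

  record _≈ᶜ_ (C C′ : Cycle G) : Set where
    field
      same-vertices : ∀ {v} → v ∈ Cycle.vertices C ⇔ v ∈ Cycle.vertices C′
      same-edges    : ∀ {u w} → Cycle.Edge C u w ⇔ Cycle.Edge C′ u w

  ≈ᶜ-refl : ∀ {C} → C ≈ᶜ C
  ≈ᶜ-refl = record { same-vertices = ⇔-id _ ; same-edges = ⇔-id _ }

  ≈ᶜ-trans : ∀ {C C′ C″} → C ≈ᶜ C′ → C′ ≈ᶜ C″ → C ≈ᶜ C″
  ≈ᶜ-trans p q = record
    { same-vertices = _≈ᶜ_.same-vertices q ⇔-∘ _≈ᶜ_.same-vertices p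
    ; same-edges    = _≈ᶜ_.same-edges q ⇔-∘ _≈ᶜ_.same-edges p }

  rotate₁ : Cycle G → Cycle G
  rotate₁ record { rest = [] ; long = () }
  rotate₁ record { start = s ; rest = h ∷ r ; long = s≤s lg ; unique = u ; walk = e ∷ʷ w } = record
    { start = h ; rest = r ++ [ s ] ; long = long′ r lg
    ; unique = unique-swap [ s ] u ; walk = w ⟨ e ⟩ [ h ]ʷ }
    where
    long′ : ∀ r → length r ≥ 1 → length (r ++ [ s ]) ≥ 2
    long′ (_ ∷ xs) _ = s≤s (nonempty xs)
      where
      nonempty : ∀ xs → length (xs ++ [ s ]) ≥ 1
      nonempty []      = s≤s z≤n
      nonempty (_ ∷ _) = s≤s z≤n

  rotate₁-≈ᶜ : ∀ C → C ≈ᶜ rotate₁ C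
  rotate₁-≈ᶜ record { rest = [] ; long = () }
  rotate₁-≈ᶜ record { start = s ; rest = h ∷ r ; long = s≤s _ ; walk = _ ∷ʷ _ } = record
    { same-vertices = mk⇔ to from
    ; same-edges = mk⇔ (Data.Sum.map to′ to′) (Data.Sum.map from′ from′) }
    where
    to′ : ∀ {x y} → Consec x y (s ∷ h ∷ r ++ [ s ]) → Consec x y (h ∷ (r ++ [ s ]) ++ [ h ])
    to′ = Equivalence.to (consec-rotate s h r)
    from′ : ∀ {x y} → Consec x y (h ∷ (r ++ [ s ]) ++ [ h ]) → Consec x y (s ∷ h ∷ r ++ [ s ])
    from′ = Equivalence.from (consec-rotate s h r)
    to : ∀ {v} → v ∈ s ∷ h ∷ r → v ∈ h ∷ r ++ [ s ]
    to (here v≡s) = ∈-++⁺ʳ (h ∷ r) (here v≡s)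
    to (there v∈) = ∈-++⁺ˡ v∈
    from : ∀ {v} → v ∈ h ∷ r ++ [ s ] → v ∈ s ∷ h ∷ r
    from v∈ with ∈-++⁻ (h ∷ r) v∈
    ... | inj₁ v∈hr = there v∈hr
    ... | inj₂ (here v≡s) = here v≡s

  rotate : ∀ (C : Cycle G) {z} pre post → Cycle.vertices C ≡ pre ++ z ∷ post →
           Σ (Cycle G) λ C′ → Cycle.start C′ ≡ z × C ≈ᶜ C′
  rotate C [] post refl = C , refl , ≈ᶜ-refl
  rotate record { rest = [] ; long = () } (_ ∷ _) _ _
  rotate C@record { start = s ; rest = h ∷ r ; long = s≤s _ ; walk = _ ∷ʷ _ } {z} (_ ∷ pre) post eq
    with rotate (rotate₁ C) pre (post ++ [ s ])
                (trans (cong (_++ [ s ]) (∷-injectiveʳ eq)) (++-assoc pre (z ∷ post) [ s ]))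
  ... | C′ , refl , C₁≈C′ = C′ , refl , ≈ᶜ-trans (rotate₁-≈ᶜ C) C₁≈C′

  rotateTo : ∀ (C : Cycle G) {z} → z ∈ Cycle.vertices C → Σ (Cycle G) λ C′ → Cycle.start C′ ≡ z × C ≈ᶜ C′
  rotateTo C z∈ with ∈-∃++ z∈
  ... | pre , post , eq = rotate C pre post eq

  record Opening (C : Cycle G) (z : V) : Set where
    field
      first last : V
      path       : List V
      walk       : Walk G first last path
      into       : G z first
      out        : G last z
      first≢last : first ≢ last
      unique     : Unique path
      z∉path     : z ∉ path
      vertices   : ∀ {v} → v ∈ Cycle.vertices C ⇔ (v ≡ z ⊎ v ∈ path)
      edges      : ∀ {x} → Cycle.Edge C x z ⇔ (x ≡ first ⊎ x ≡ last)

  opening-≈ᶜ : ∀ {C C′ z} → C ≈ᶜ C′ → Opening C′ z → Opening C z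
  opening-≈ᶜ C≈C′ O = record
    { first = first ; last = last ; path = path ; walk = walk ; into = into ; out = out
    ; first≢last = first≢last ; unique = unique ; z∉path = z∉path
    ; vertices = vertices ⇔-∘ _≈ᶜ_.same-vertices C≈C′
    ; edges    = edges ⇔-∘ _≈ᶜ_.same-edges C≈C′ }
    where open Opening O

  openAtStart : (C : Cycle G) → Opening C (Cycle.start C)
  openAtStart record { rest = [] ; long = () }
  openAtStart record { start = z ; rest = h ∷ r ; long = s≤s lg ; unique = u@(_ ∷ u′) ; walk = e ∷ʷ w }
    with walk-unsnoc h r z w
  ... | w′ , e′ = record
    { first = h ; last = lastOf h r ; path = h ∷ r ; walk = w′ ; into = e ; out = e′
    ; first≢last = h≢last r lg u′ ; unique = u′ ; z∉path = z∉
    ; vertices = mk⇔ (λ { (here v≡z) → inj₁ v≡z ; (there v∈) → inj₂ v∈ })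
                     (λ { (inj₁ v≡z) → here v≡z ; (inj₂ v∈) → there v∈ })
    ; edges = mk⇔ edge⇒ ⇒edge }
    where
    z∉ : z ∉ h ∷ r
    z∉ = Unique[x∷xs]⇒x∉xs u
    h≢last : ∀ r → length r ≥ 1 → Unique (h ∷ r) → h ≢ lastOf h r
    h≢last (x ∷ r) _ uhr h≡last = Unique[x∷xs]⇒x∉xs uhr (subst (_∈ x ∷ r) (sym h≡last) (lastOf-∈ x r))
    edge⇒ : ∀ {x} → Consec x z (z ∷ h ∷ r ++ [ z ]) ⊎ Consec z x (z ∷ h ∷ r ++ [ z ]) →
            x ≡ h ⊎ x ≡ lastOf h r
    edge⇒ (inj₁ here) = ⊥-elim (z∉ (here refl))
    edge⇒ (inj₁ (there c)) with consec-snoc⁻ h r c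
    ... | inj₁ c′ = ⊥-elim (z∉ (consec-∈₂ c′))
    ... | inj₂ (x≡last , _) = inj₂ x≡last
    edge⇒ (inj₂ here) = inj₁ refl
    edge⇒ (inj₂ (there c)) with consec-snoc⁻ h r c
    ... | inj₁ c′ = ⊥-elim (z∉ (consec-∈₁ c′))
    ... | inj₂ (z≡last , _) = ⊥-elim (z∉ (subst (_∈ h ∷ r) (sym z≡last) (lastOf-∈ h r)))
    ⇒edge : ∀ {x} → x ≡ h ⊎ x ≡ lastOf h r →
            Consec x z (z ∷ h ∷ r ++ [ z ]) ⊎ Consec z x (z ∷ h ∷ r ++ [ z ])
    ⇒edge (inj₁ refl) = inj₂ here
    ⇒edge (inj₂ refl) = inj₁ (there (consec-last h r [] z))

  openAt : (C : Cycle G) {z : V} → z ∈ Cycle.vertices C → Opening C z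
  openAt C z∈ with rotateTo C z∈
  ... | C′ , refl , C≈C′ = opening-≈ᶜ C≈C′ (openAtStart C′)

-- Deleting a vertex

punchIn-preimage : ∀ {n} (z : Fin (suc n)) xs → z ∉ xs → Σ (List (Fin n)) λ S → map (punchIn z) S ≡ xs
punchIn-preimage z []       _   = [] , refl
punchIn-preimage z (x ∷ xs) z∉ with punchIn-preimage z xs (λ z∈ → z∉ (there z∈))
... | S , refl = punchOut z≢x ∷ S , cong (_∷ map (punchIn z) S) (punchIn-punchOut z≢x)
  where
  z≢x : z ≢ x
  z≢x z≡x = z∉ (here z≡x)

∉-punchIn-image : ∀ {n} (i : Fin (suc n)) xs → i ∉ map (punchIn i) xs
∉-punchIn-image i xs i∈ with ∈-map⁻ (punchIn i) i∈
... | j , _ , i≡ = punchInᵢ≢i i j (sym i≡)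

∈-punchIn-image : ∀ {n} (i : Fin (suc n)) {xs} → (∀ j → j ∈ xs) → ∀ v → v ≢ i → v ∈ map (punchIn i) xs
∈-punchIn-image i covers v v≢i =
  subst (_∈ _) (punchIn-punchOut i≢v) (∈-map⁺ (punchIn i) (covers (punchOut i≢v)))
  where
  i≢v : i ≢ v
  i≢v i≡v = v≢i (sym i≡v)

module _ {n : ℕ} {G : Graph (Fin (suc n))} where

  record Opening⁻ (C : Cycle G) (z : Fin (suc n)) : Set where
    field
      first last : Fin n
      path       : List (Fin n)
      walk       : Walk (deleteVertex G z) first last path
      into       : G z (punchIn z first)
      out        : G (punchIn z last) z
      first≢last : first ≢ last
      unique     : Unique path
      vertices   : ∀ {p} → p ∈ path ⇔ punchIn z p ∈ Cycle.vertices C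
      edges      : ∀ {x} → Cycle.Edge C x z ⇔ (x ≡ punchIn z first ⊎ x ≡ punchIn z last)

  module _ {C : Cycle G} {z : Fin (suc n)} (O : Opening C z) where
    open Opening O

    opening⇒opening⁻ : Opening⁻ C z
    opening⇒opening⁻ with punchIn-preimage z path z∉path
    ... | [] , eq with subst (first ∈_) (sym eq) (walk-first walk)
    ... | ()
    opening⇒opening⁻ | s ∷ S , eq with walk-unmap (punchIn z) s S (subst (Walk G first last) (sym eq) walk)
    ... | refl , t , refl , w = record
      { first = s ; last = t ; path = s ∷ S ; walk = w ; into = into ; out = out
      ; first≢last = λ s≡t → first≢last (cong (punchIn z) s≡t)
      ; unique = unique-map⁻ (subst Unique (sym eq) unique)
      ; vertices = mk⇔ to from
      ; edges = edges }
      where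
      to : ∀ {p} → p ∈ s ∷ S → punchIn z p ∈ Cycle.vertices C
      to p∈ = Equivalence.from vertices (inj₂ (subst (_ ∈_) eq (∈-map⁺ (punchIn z) p∈)))
      from : ∀ {p} → punchIn z p ∈ Cycle.vertices C → p ∈ s ∷ S
      from p∈ with Equivalence.to vertices p∈
      ... | inj₁ pI≡z = ⊥-elim (punchInᵢ≢i z _ pI≡z)
      ... | inj₂ pI∈ with ∈-map⁻ (punchIn z) (subst (_ ∈_) (sym eq) pI∈)
      ... | q , q∈ , pI≡ = subst (_∈ s ∷ S) (sym (punchIn-injective z _ _ pI≡)) q∈

  openAt⁻ : (C : Cycle G) {z : Fin (suc n)} → z ∈ Cycle.vertices C → Opening⁻ C z
  openAt⁻ C z∈ = opening⇒opening⁻ (openAt C z∈)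

record HamWalk {V : Set} (G : Graph V) (missing : List V) (s t : V) : Set where
  field
    verts    : List V
    walk     : Walk G s t verts
    eachOnce : EachOnce (missing ++ verts)

module _ {G : Graph V} where

  hamWalk-reverse : (∀ {x y} → G x y → G y x) → ∀ {M s t} → HamWalk G M s t → HamWalk G M t s
  hamWalk-reverse G-sym {M} W = record
    { verts = reverse verts ; walk = walk-reverse G-sym walk ; eachOnce = eachOnce-reverse M verts eachOnce }
    where open HamWalk W

  hamWalk-missing-first : ∀ {e M t} → HamWalk G (e ∷ M) e t → ⊥
  hamWalk-missing-first W = Unique[x∷xs]⇒x∉xs (proj₁ eachOnce) (∈-++⁺ʳ _ (walk-first walk))
    where open HamWalk W

record Hypotheses (R : Rooted) : Set where
  open Rooted R
  field
    H-sym               : ∀ {u v} → H u v → H v u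
    H-irrefl            : ∀ v → ¬ H v v
    H-cubic             : Cubic H
    nonHamiltonian      : ¬ Hamiltonian H
    addEdge-hamiltonian : ∀ u v → u ≢ v → ¬ H u v → Hamiltonian (addEdge H u v)
    hypohamiltonian     : ∀ v → Hamiltonian (deleteVertex H v)
    a≢b                 : a ≢ b
    a≢c                 : a ≢ c
    b≢c                 : b ≢ c
    z-a                 : H z a
    z-b                 : H z b
    z-c                 : H z c
    neighbours-z        : ∀ w → H z w → w ≡ a ⊎ (w ≡ b ⊎ w ≡ c)
    cycle-through-az    : ∀ u → u ≢ z → ¬ H z u → Σ (HamCycle (addEdge H z u)) λ C → EdgeOf C a z
    cycle-avoiding-az   : ∀ u → u ≢ z → ¬ H z u → Σ (HamCycle (addEdge H z u)) λ C → ¬ EdgeOf C a z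

hypotheses : ∀ {R} → Good R → Hypotheses R
hypotheses ((sym′ , irr) , cubic , (nonham , add , del) , ((ab , ac , bc) , (za , zb , zc) , nz) , cond) = record
  { H-sym = sym′ _ _ ; H-irrefl = irr ; H-cubic = cubic ; nonHamiltonian = nonham
  ; addEdge-hamiltonian = add ; hypohamiltonian = del ; a≢b = ab ; a≢c = ac ; b≢c = bc
  ; z-a = za ; z-b = zb ; z-c = zc ; neighbours-z = nz
  ; cycle-through-az = λ u u≢z nzu → proj₁ (cond u u≢z nzu)
  ; cycle-avoiding-az = λ u u≢z nzu → proj₂ (cond u u≢z nzu) }

pattern isA = here refl
pattern isB = there (here refl)
pattern isC = there (there (here refl))

-- The graph F = H − z and its exits

module Opened (R : Rooted) (good : Good R) where
  open Rooted R
  open Hypotheses (hypotheses good) public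

  F : Graph (Fin m)
  F = deleteVertex H z

  F-sym : ∀ {p q} → F p q → F q p
  F-sym = H-sym

  emb-injective : ∀ {p q} → emb R p ≡ emb R q → p ≡ q
  emb-injective = punchIn-injective z _ _

  emb≢z : ∀ p → emb R p ≢ z
  emb≢z = punchInᵢ≢i z

  private
    z≢ : ∀ {w} → H z w → z ≢ w
    z≢ zw refl = H-irrefl _ zw

  a′ b′ c′ : Fin m
  a′ = punchOut (z≢ z-a)
  b′ = punchOut (z≢ z-b)
  c′ = punchOut (z≢ z-c)

  emb-a′ : emb R a′ ≡ a
  emb-a′ = punchIn-punchOut (z≢ z-a)

  emb-b′ : emb R b′ ≡ b
  emb-b′ = punchIn-punchOut (z≢ z-b)

  emb-c′ : emb R c′ ≡ c
  emb-c′ = punchIn-punchOut (z≢ z-c)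

  ≡a′ : ∀ {p} → emb R p ≡ a → p ≡ a′
  ≡a′ p≡a = emb-injective (trans p≡a (sym emb-a′))

  ≡b′ : ∀ {p} → emb R p ≡ b → p ≡ b′
  ≡b′ p≡b = emb-injective (trans p≡b (sym emb-b′))

  ≡c′ : ∀ {p} → emb R p ≡ c → p ≡ c′
  ≡c′ p≡c = emb-injective (trans p≡c (sym emb-c′))

  exits : List (Fin m)
  exits = a′ ∷ b′ ∷ c′ ∷ []

  Exit : Fin m → Set
  Exit p = p ∈ exits

  adjacent⇒exit : ∀ {p} → H z (emb R p) → Exit p
  adjacent⇒exit z-p with neighbours-z _ z-p
  ... | inj₁ p≡a        = here (≡a′ p≡a)
  ... | inj₂ (inj₁ p≡b) = there (here (≡b′ p≡b))
  ... | inj₂ (inj₂ p≡c) = there (there (here (≡c′ p≡c)))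

  exit⇒adjacent : ∀ {p} → Exit p → H z (emb R p)
  exit⇒adjacent isA = subst (H z) (sym emb-a′) z-a
  exit⇒adjacent isB = subst (H z) (sym emb-b′) z-b
  exit⇒adjacent isC = subst (H z) (sym emb-c′) z-c

  exit-≢a′ : ∀ {p} → Exit p → p ≢ a′ → p ≡ b′ ⊎ p ≡ c′
  exit-≢a′ isA p≢a′ = ⊥-elim (p≢a′ refl)
  exit-≢a′ isB _    = inj₁ refl
  exit-≢a′ isC _    = inj₂ refl

  no-four-exits : ∀ {p q r s} → Unique (p ∷ q ∷ r ∷ s ∷ []) → Exit p → Exit q → Exit r → Exit s → ⊥
  no-four-exits u ep eq er es = 4≰3 (unique⊆⇒length≤ u ⊆exits)
    where
    ⊆exits : ∀ {v} → v ∈ _ ∷ _ ∷ _ ∷ _ ∷ [] → Exit v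
    ⊆exits (here refl)                         = ep
    ⊆exits (there (here refl))                 = eq
    ⊆exits (there (there (here refl)))         = er
    ⊆exits (there (there (there (here refl)))) = es
    4≰3 : ¬ (4 ≤ 3)
    4≰3 (s≤s (s≤s (s≤s ())))

  closeUp : ∀ {s t} → HamWalk F [] s t → s ≢ t → Exit s → Exit t → Hamiltonian H
  closeUp {s} {t} W s≢t es et = record
    { start = z ; rest = map (emb R) verts ; long = long walk
    ; unique = unique-∷ (∉-punchIn-image z verts) (unique-map⁺ emb-injective (proj₁ eachOnce))
    ; covers = covers
    ; linked = walk⇒linked
                 (exit⇒adjacent es ◅ (walk-map (emb R) (λ r → r) walk ⟨ H-sym (exit⇒adjacent et) ⟩ [ z ]ʷ)) }
    where
    open HamWalk W
    long : ∀ {xs} → Walk F s t xs → length (map (emb R) xs) ≥ 2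
    long [ _ ]ʷ    = ⊥-elim (s≢t refl)
    long (_ ∷ʷ _) = s≤s (s≤s z≤n)
    covers : ∀ v → v ∈ z ∷ map (emb R) verts
    covers v with v ≟ z
    ... | yes v≡z = here v≡z
    ... | no v≢z  = there (∈-punchIn-image z (proj₂ eachOnce) v v≢z)

  ∃hamWalkFrom : ∀ w → Σ (Fin m) λ t → HamWalk F [] w t
  ∃hamWalkFrom w with rotateTo (fromHamCycle (hypohamiltonian z)) (HamCycle.covers (hypohamiltonian z) w)
  ... | C , refl , C₀≈C = lastOf w rest , record
    { verts = w ∷ rest ; walk = proj₁ (walk-unsnoc w rest w walk)
    ; eachOnce = unique , λ v → Equivalence.to (_≈ᶜ_.same-vertices C₀≈C) (HamCycle.covers (hypohamiltonian z) v) }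
    where open Cycle C

  hamWalkFrom : ∀ w → HamWalk F [] w (proj₁ (∃hamWalkFrom w))
  hamWalkFrom w = proj₂ (∃hamWalkFrom w)

  hamWalkTo : ∀ w → HamWalk F [] (proj₁ (∃hamWalkFrom w)) w
  hamWalkTo w = hamWalk-reverse F-sym (hamWalkFrom w)

  exit? : ∀ p → Dec (Exit p)
  exit? p = p ∈? exits
    where open import Data.List.Membership.DecPropositional (_≟_ {m}) using (_∈?_)

  ExitPair : (Fin m → Fin m → Set) → Set
  ExitPair P = P b′ c′ ⊎ P a′ b′ ⊎ P a′ c′

  orientExits : ∀ {P : Fin m → Fin m → Set} → (∀ {s t} → P s t → P t s) →
                ∀ {s t} → Exit s → Exit t → s ≢ t → P s t → ExitPair P
  orientExits swap isA isA s≢t _ = ⊥-elim (s≢t refl)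
  orientExits swap isA isB _   P = inj₂ (inj₁ P)
  orientExits swap isA isC _   P = inj₂ (inj₂ P)
  orientExits swap isB isA _   P = inj₂ (inj₁ (swap P))
  orientExits swap isB isB s≢t _ = ⊥-elim (s≢t refl)
  orientExits swap isB isC _   P = inj₁ P
  orientExits swap isC isA _   P = inj₂ (inj₂ (swap P))
  orientExits swap isC isB _   P = inj₁ (swap P)
  orientExits swap isC isC s≢t _ = ⊥-elim (s≢t refl)
  orientExits swap _ (there (there (there ()))) _ _
  orientExits swap (there (there (there ()))) _ _ _

  -- Open a hamiltonian cycle of H − e at z.
  exitWalk : ∀ e → ExitPair (HamWalk F [ e ])
  exitWalk e =
    orientExits {P = HamWalk F [ e ]} (hamWalk-reverse F-sym) (adjacent⇒exit into) (adjacent⇒exit (H-sym out)) first≢last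
    record { verts = path ; walk = walk ; eachOnce = unique-∷ e∉ unique , covers }
    where
    C : Cycle H
    C = cycle-map (punchIn (emb R e)) (punchIn-injective _ _ _) (λ r → r)
                  (fromHamCycle (hypohamiltonian (emb R e)))
    open Opening⁻ (openAt⁻ C (∈-punchIn-image (emb R e) (HamCycle.covers (hypohamiltonian (emb R e))) z
                                (λ z≡e → emb≢z e (sym z≡e))))
    e∉ : e ∉ path
    e∉ e∈ = ∉-punchIn-image (emb R e) _ (Equivalence.to vertices e∈)
    covers : ∀ p → p ∈ e ∷ path
    covers p with p ≟ e
    ... | yes p≡e = here p≡e
    ... | no p≢e  = there (Equivalence.from vertices
                     (∈-punchIn-image (emb R e) (HamCycle.covers (hypohamiltonian (emb R e))) (emb R p)
                        (λ p≡e → p≢e (emb-injective p≡e))))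

  private
    hamWalk-missing-last : ∀ {e M s} → HamWalk F (e ∷ M) s e → ⊥
    hamWalk-missing-last W = hamWalk-missing-first (hamWalk-reverse F-sym W)

  avoidA : HamWalk F [ a′ ] b′ c′
  avoidA with exitWalk a′
  ... | inj₁ W        = W
  ... | inj₂ (inj₁ W) = ⊥-elim (hamWalk-missing-first W)
  ... | inj₂ (inj₂ W) = ⊥-elim (hamWalk-missing-first W)

  avoidB : HamWalk F [ b′ ] a′ c′
  avoidB with exitWalk b′
  ... | inj₁ W        = ⊥-elim (hamWalk-missing-first W)
  ... | inj₂ (inj₁ W) = ⊥-elim (hamWalk-missing-last W)
  ... | inj₂ (inj₂ W) = W

  avoidC : HamWalk F [ c′ ] a′ b′
  avoidC with exitWalk c′
  ... | inj₁ W        = ⊥-elim (hamWalk-missing-last W)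
  ... | inj₂ (inj₁ W) = W
  ... | inj₂ (inj₂ W) = ⊥-elim (hamWalk-missing-last W)

  avoidA⁻ : HamWalk F [ a′ ] c′ b′
  avoidA⁻ = hamWalk-reverse F-sym avoidA

  avoidB⁻ : HamWalk F [ b′ ] c′ a′
  avoidB⁻ = hamWalk-reverse F-sym avoidB

  avoidC⁻ : HamWalk F [ c′ ] b′ a′
  avoidC⁻ = hamWalk-reverse F-sym avoidC

  module _ {u : Fin m} (¬exit : ¬ Exit u) (C : HamCycle (addEdge H z (emb R u))) where
    private
      open Opening⁻ (openAt⁻ (fromHamCycle C) (HamCycle.covers C z))

      toF : ∀ {p q} → addEdge H z (emb R u) (emb R p) (emb R q) → F p q
      toF (inj₁ r)                  = r
      toF (inj₂ (inj₁ (p≡z , _)))   = ⊥-elim (emb≢z _ p≡z)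
      toF (inj₂ (inj₂ (_ , q≡z)))   = ⊥-elim (emb≢z _ q≡z)

      end : ∀ {p} → addEdge H z (emb R u) z (emb R p) → p ≡ u ⊎ Exit p
      end (inj₁ r)                  = inj₂ (adjacent⇒exit r)
      end (inj₂ (inj₁ (_ , p≡u)))   = inj₁ (emb-injective p≡u)
      end (inj₂ (inj₂ (z≡u , _)))   = ⊥-elim (emb≢z u (sym z≡u))

      opened : HamWalk F [] first last
      opened = record { verts = path ; walk = walk-weaken toF walk
                 ; eachOnce = unique , λ p → Equivalence.from vertices (HamCycle.covers C _) }

      az-edges : EdgeOf C a z ⇔ (a ≡ emb R first ⊎ a ≡ emb R last)
      az-edges = edges ⇔-∘ mk⇔ (edgeOf⇒edge C) (edge⇒edgeOf C)

    WalkToExit : Set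
    WalkToExit = Σ (Fin m) λ w → HamWalk F [] u w × Exit w × (EdgeOf C a z ⇔ w ≡ a′)

    private
      oriented : ∀ {t} → HamWalk F [] u t → Exit t → (EdgeOf C a z ⇔ (a ≡ emb R u ⊎ a ≡ emb R t)) → WalkToExit
      oriented {t} W et iff = t , W , et , mk⇔ to from
        where
        to : EdgeOf C a z → t ≡ a′
        to az with Equivalence.to iff az
        ... | inj₁ a≡u = ⊥-elim (¬exit (here (≡a′ (sym a≡u))))
        ... | inj₂ a≡t = ≡a′ (sym a≡t)
        from : t ≡ a′ → EdgeOf C a z
        from t≡a′ = Equivalence.from iff (inj₂ (trans (sym emb-a′) (cong (emb R) (sym t≡a′))))

    -- The ends of the opened cycle are not both exits, as H is not hamiltonian.
    cycleWalk : WalkToExit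
    cycleWalk with end into | end (addEdge-sym {G = H} H-sym {u = z} {v = emb R u} out)
    ... | inj₁ f≡u | inj₁ l≡u = ⊥-elim (first≢last (trans f≡u (sym l≡u)))
    ... | inj₁ f≡u | inj₂ el  =
      oriented (subst (λ s → HamWalk F [] s last) f≡u opened) el
               (subst (λ s → EdgeOf C a z ⇔ (a ≡ emb R s ⊎ a ≡ emb R last)) f≡u az-edges)
    ... | inj₂ ef  | inj₁ l≡u =
      oriented (subst (λ t → HamWalk F [] t first) l≡u (hamWalk-reverse F-sym opened)) ef
               (subst (λ t → EdgeOf C a z ⇔ (a ≡ emb R t ⊎ a ≡ emb R first)) l≡u
                      (mk⇔ (Data.Sum.swap ∘′ Equivalence.to az-edges) (Equivalence.from az-edges ∘′ Data.Sum.swap)))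
    ... | inj₂ ef  | inj₂ el  = ⊥-elim (nonHamiltonian (closeUp opened first≢last ef el))

  nonExitWalk-a′ : ∀ {u} → ¬ Exit u → HamWalk F [] u a′
  nonExitWalk-a′ {u} ¬exit with cycle-through-az (emb R u) (emb≢z u) (λ z-u → ¬exit (adjacent⇒exit z-u))
  ... | C , az∈C with cycleWalk ¬exit C
  ... | w , W , _ , iff = subst (HamWalk F [] u) (Equivalence.to iff az∈C) W

  nonExitWalk-b′c′ : ∀ {u} → ¬ Exit u → Σ (Fin m) λ w → HamWalk F [] u w × (w ≡ b′ ⊎ w ≡ c′)
  nonExitWalk-b′c′ {u} ¬exit with cycle-avoiding-az (emb R u) (emb≢z u) (λ z-u → ¬exit (adjacent⇒exit z-u))
  ... | C , az∉C with cycleWalk ¬exit C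
  ... | w , W , ew , iff = w , W , exit-≢a′ ew (λ w≡a′ → az∉C (Equivalence.from iff w≡a′))

  addedWalk : ∀ {p q} → p ≢ q → ¬ F p q → ExitPair (HamWalk (addEdge F p q) [])
  addedWalk {p} {q} p≢q ¬pq =
    orientExits {P = HamWalk (addEdge F p q) []} (hamWalk-reverse (addEdge-sym {G = F} F-sym {u = p} {v = q}))
      (exit into) (exit (addEdge-sym {G = H} H-sym {u = emb R p} {v = emb R q} out)) first≢last
      record { verts = path ; walk = walk-weaken toF walk
             ; eachOnce = unique , λ v → Equivalence.from vertices (HamCycle.covers C _) }
    where
    C : HamCycle (addEdge H (emb R p) (emb R q))
    C = addEdge-hamiltonian (emb R p) (emb R q) (λ p≡q → p≢q (emb-injective p≡q)) ¬pq
    open Opening⁻ (openAt⁻ (fromHamCycle C) (HamCycle.covers C z))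
    toF : ∀ {x y} → addEdge H (emb R p) (emb R q) (emb R x) (emb R y) → addEdge F p q x y
    toF (inj₁ r)                  = inj₁ r
    toF (inj₂ (inj₁ (x≡p , y≡q))) = inj₂ (inj₁ (emb-injective x≡p , emb-injective y≡q))
    toF (inj₂ (inj₂ (x≡q , y≡p))) = inj₂ (inj₂ (emb-injective x≡q , emb-injective y≡p))
    exit : ∀ {x} → addEdge H (emb R p) (emb R q) z (emb R x) → Exit x
    exit (inj₁ r)                 = adjacent⇒exit r
    exit (inj₂ (inj₁ (z≡p , _)))  = ⊥-elim (emb≢z p (sym z≡p))
    exit (inj₂ (inj₂ (z≡q , _)))  = ⊥-elim (emb≢z q (sym z≡q))

-- Routes in K4[H₁,H₂,H₃]

module Routes (R₁ R₂ R₃ : Rooted) where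

  -- The apex and the three parts, as Fin 4 for its decidable equality.
  Part : Set
  Part = Fin 4

  pattern X  = Fin.zero
  pattern F₁ = Fin.suc Fin.zero
  pattern F₂ = Fin.suc (Fin.suc Fin.zero)
  pattern F₃ = Fin.suc (Fin.suc (Fin.suc Fin.zero))

  Vert : Part → Set
  Vert X  = ⊤
  Vert F₁ = Fin (Rooted.m R₁)
  Vert F₂ = Fin (Rooted.m R₂)
  Vert F₃ = Fin (Rooted.m R₃)

  vert : ∀ i → Vert i → KV R₁ R₂ R₃
  vert X  _ = xv
  vert F₁ p = v₁ p
  vert F₂ p = v₂ p
  vert F₃ p = v₃ p

  part : KV R₁ R₂ R₃ → Part
  part xv     = X
  part (v₁ _) = F₁
  part (v₂ _) = F₂
  part (v₃ _) = F₃

  part-vert : ∀ i p → part (vert i p) ≡ i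
  part-vert X  _ = refl
  part-vert F₁ _ = refl
  part-vert F₂ _ = refl
  part-vert F₃ _ = refl

  vert-injective : ∀ i {p q} → vert i p ≡ vert i q → p ≡ q
  vert-injective X  refl = refl
  vert-injective F₁ refl = refl
  vert-injective F₂ refl = refl
  vert-injective F₃ refl = refl

  vert-surjective : ∀ v → Σ Part λ i → Σ (Vert i) λ p → vert i p ≡ v
  vert-surjective xv     = X , tt , refl
  vert-surjective (v₁ p) = F₁ , p , refl
  vert-surjective (v₂ p) = F₂ , p , refl
  vert-surjective (v₃ p) = F₃ , p , refl

  Block : Set
  Block = Σ Part λ i → List (Vert i)

  flatten : List Block → List (KV R₁ R₂ R₃)
  flatten []             = []
  flatten ((i , S) ∷ bs) = map (vert i) S ++ flatten bs

  select : ∀ i j → List (Vert j) → List (Vert i)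
  select i j S with j ≟ i
  ... | yes refl = S
  ... | no _     = []

  column : ∀ i → List Block → List (Vert i)
  column i []             = []
  column i ((j , S) ∷ bs) = select i j S ++ column i bs

  select-self : ∀ i S → select i i S ≡ S
  select-self i S with i ≟ i
  ... | yes refl = refl
  ... | no i≢i   = ⊥-elim (i≢i refl)

  ∈-select : ∀ i j {p} S → p ∈ select i j S ⇔ vert i p ∈ map (vert j) S
  ∈-select i j {p} S with j ≟ i
  ... | yes refl = mk⇔ (∈-map⁺ (vert i)) from
    where
    from : vert i p ∈ map (vert i) S → p ∈ S
    from v∈ with ∈-map⁻ (vert i) v∈
    ... | q , q∈ , eq = subst (_∈ S) (sym (vert-injective i eq)) q∈
  ... | no j≢i = mk⇔ (λ ()) from
    where
    from : vert i p ∈ map (vert j) S → p ∈ []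
    from v∈ with ∈-map⁻ (vert j) v∈
    ... | q , _ , eq = ⊥-elim (j≢i (trans (sym (part-vert j q)) (trans (cong part (sym eq)) (part-vert i p))))

  ∈-flatten : ∀ i {p} bs → vert i p ∈ flatten bs ⇔ p ∈ column i bs
  ∈-flatten i []             = mk⇔ (λ ()) (λ ())
  ∈-flatten i ((j , S) ∷ bs) = mk⇔ to from
    where
    to : vert i _ ∈ map (vert j) S ++ flatten bs → _ ∈ select i j S ++ column i bs
    to v∈ with ∈-++⁻ (map (vert j) S) v∈
    ... | inj₁ v∈S  = ∈-++⁺ˡ (Equivalence.from (∈-select i j S) v∈S)
    ... | inj₂ v∈bs = ∈-++⁺ʳ (select i j S) (Equivalence.to (∈-flatten i bs) v∈bs)
    from : _ ∈ select i j S ++ column i bs → vert i _ ∈ map (vert j) S ++ flatten bs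
    from p∈ with ∈-++⁻ (select i j S) p∈
    ... | inj₁ p∈S  = ∈-++⁺ˡ (Equivalence.to (∈-select i j S) p∈S)
    ... | inj₂ p∈bs = ∈-++⁺ʳ (map (vert j) S) (Equivalence.from (∈-flatten i bs) p∈bs)

  unique-flatten : ∀ bs → (∀ i → Unique (column i bs)) → Unique (flatten bs)
  unique-flatten []             _ = []
  unique-flatten ((j , S) ∷ bs) u with unique-++⁻ (select j j S) (u j)
  ... | uS , _ , disj =
    unique-++⁺ (unique-map⁺ (vert-injective j) (subst Unique (select-self j S) uS))
               (unique-flatten bs (λ i → proj₁ (proj₂ (unique-++⁻ (select i j S) (u i)))))
               (λ (v∈S , v∈bs) → apart v∈S v∈bs)
    where
    apart : ∀ {v} → v ∈ map (vert j) S → v ∈ flatten bs → ⊥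
    apart v∈S v∈bs with ∈-map⁻ (vert j) v∈S
    ... | q , q∈S , refl =
      disj (subst (q ∈_) (sym (select-self j S)) q∈S , Equivalence.to (∈-flatten j bs) v∈bs)

  record Route (G : Graph (KV R₁ R₂ R₃)) (s t : KV R₁ R₂ R₃) (bs : List Block) : Set where
    constructor route
    field walk : Walk G s t (flatten bs)

  flatten-++ : ∀ bs cs → flatten (bs ++ cs) ≡ flatten bs ++ flatten cs
  flatten-++ []             cs = refl
  flatten-++ ((i , S) ∷ bs) cs =
    trans (cong (map (vert i) S ++_) (flatten-++ bs cs))
          (sym (++-assoc (map (vert i) S) (flatten bs) (flatten cs)))

  module _ {G : Graph (KV R₁ R₂ R₃)} where

    infixr 5 _⟨_⟩ʳ_

    _⟨_⟩ʳ_ : ∀ {s t u v bs cs} → Route G s t bs → G t u → Route G u v cs → Route G s v (bs ++ cs)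
    _⟨_⟩ʳ_ {s = s} {v = v} {bs} {cs} (route W) e (route W′) =
      route (subst (Walk G s v) (sym (flatten-++ bs cs)) (W ⟨ e ⟩ W′))

    piece : ∀ i {s t S} → Walk G (vert i s) (vert i t) (map (vert i) S) → Route G (vert i s) (vert i t) [ i , S ]
    piece i {s} {t} {S} W = route (subst (Walk G (vert i s) (vert i t)) (sym (++-identityʳ (map (vert i) S))) W)

    apex : Route G xv xv [ X , [ tt ] ]
    apex = route [ xv ]ʷ

    route⇒hamPath : ∀ {s t bs} → Route G s t bs →
                    EachOnce (column X bs) → EachOnce (column F₁ bs) →
                    EachOnce (column F₂ bs) → EachOnce (column F₃ bs) →
                    HamPath G
    route⇒hamPath {bs = bs} (route W) eX e₁ e₂ e₃ = record
      { verts = flatten bs ; linked = walk⇒linked W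
      ; unique = unique-flatten bs (λ i → proj₁ (columns i))
      ; covers = covers }
      where
      columns : ∀ i → EachOnce (column i bs)
      columns X  = eX
      columns F₁ = e₁
      columns F₂ = e₂
      columns F₃ = e₃
      covers : ∀ v → v ∈ flatten bs
      covers v with vert-surjective v
      ... | i , p , refl = Equivalence.from (∈-flatten i bs) (proj₂ (columns i) p)

  apex-once : EachOnce (tt ∷ [])
  apex-once = unique-∷ (λ ()) [] , λ _ → here refl

-- Traceability after adding an edge

eachOnce⁺ : ∀ {G : Graph V} {M s t} (W : HamWalk G M s t) → EachOnce ((M ++ HamWalk.verts W) ++ [])
eachOnce⁺ W = eachOnce-++[] _ (HamWalk.eachOnce W)

eachOnceʳ : ∀ {G : Graph V} {e s t} (W : HamWalk G [ e ] s t) → EachOnce (HamWalk.verts W ++ [ e ])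
eachOnceʳ {e = e} W = eachOnce-rotate e (HamWalk.verts W) (HamWalk.eachOnce W)

module Maximality (R₁ R₂ R₃ : Rooted) (g₁ : Good R₁) (g₂ : Good R₂) (g₃ : Good R₃) where
  open Routes R₁ R₂ R₃
  private
    module O₁ = Opened R₁ g₁
    module O₂ = Opened R₂ g₂
    module O₃ = Opened R₃ g₃
  open O₁ using () renaming (a′ to a₁; b′ to b₁; c′ to c₁)
  open O₂ using () renaming (a′ to a₂; b′ to b₂; c′ to c₂)
  open O₃ using () renaming (a′ to a₃; b′ to b₃; c′ to c₃)

  G : Graph (KV R₁ R₂ R₃)
  G = K4 R₁ R₂ R₃

  module WithEdge (u v : KV R₁ R₂ R₃) where
    G⁺ : Graph (KV R₁ R₂ R₃)
    G⁺ = addEdge G u v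

    new : G⁺ u v
    new = inj₂ (inj₁ (refl , refl))

    new⁻ : G⁺ v u
    new⁻ = inj₂ (inj₂ (refl , refl))

    x-a₁ : G⁺ xv (v₁ a₁)
    x-a₁ = inj₁ O₁.emb-a′
    x-a₂ : G⁺ xv (v₂ a₂)
    x-a₂ = inj₁ O₂.emb-a′
    x-a₃ : G⁺ xv (v₃ a₃)
    x-a₃ = inj₁ O₃.emb-a′
    a₁-x : G⁺ (v₁ a₁) xv
    a₁-x = inj₁ O₁.emb-a′
    a₂-x : G⁺ (v₂ a₂) xv
    a₂-x = inj₁ O₂.emb-a′
    a₃-x : G⁺ (v₃ a₃) xv
    a₃-x = inj₁ O₃.emb-a′
    b₁-c₃ : G⁺ (v₁ b₁) (v₃ c₃)
    b₁-c₃ = inj₁ (O₁.emb-b′ , O₃.emb-c′)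
    c₃-b₁ : G⁺ (v₃ c₃) (v₁ b₁)
    c₃-b₁ = inj₁ (O₁.emb-b′ , O₃.emb-c′)
    b₂-c₁ : G⁺ (v₂ b₂) (v₁ c₁)
    b₂-c₁ = inj₁ (O₂.emb-b′ , O₁.emb-c′)
    c₁-b₂ : G⁺ (v₁ c₁) (v₂ b₂)
    c₁-b₂ = inj₁ (O₂.emb-b′ , O₁.emb-c′)
    b₃-c₂ : G⁺ (v₃ b₃) (v₂ c₂)
    b₃-c₂ = inj₁ (O₃.emb-b′ , O₂.emb-c′)
    c₂-b₃ : G⁺ (v₂ c₂) (v₃ b₃)
    c₂-b₃ = inj₁ (O₃.emb-b′ , O₂.emb-c′)

    in₁ : ∀ {M s t} (W : HamWalk O₁.F M s t) → Route G⁺ (v₁ s) (v₁ t) [ F₁ , HamWalk.verts W ]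
    in₁ W = piece F₁ (walk-map v₁ inj₁ (HamWalk.walk W))
    in₂ : ∀ {M s t} (W : HamWalk O₂.F M s t) → Route G⁺ (v₂ s) (v₂ t) [ F₂ , HamWalk.verts W ]
    in₂ W = piece F₂ (walk-map v₂ inj₁ (HamWalk.walk W))
    in₃ : ∀ {M s t} (W : HamWalk O₃.F M s t) → Route G⁺ (v₃ s) (v₃ t) [ F₃ , HamWalk.verts W ]
    in₃ W = piece F₃ (walk-map v₃ inj₁ (HamWalk.walk W))

    at₁ : ∀ p → Route G⁺ (v₁ p) (v₁ p) [ F₁ , [ p ] ]
    at₁ p = piece F₁ [ v₁ p ]ʷ
    at₂ : ∀ p → Route G⁺ (v₂ p) (v₂ p) [ F₂ , [ p ] ]
    at₂ p = piece F₂ [ v₂ p ]ʷ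
    at₃ : ∀ p → Route G⁺ (v₃ p) (v₃ p) [ F₃ , [ p ] ]
    at₃ p = piece F₃ [ v₃ p ]ʷ

  traceable+x-b₁ : Traceable (addEdge G xv (v₁ b₁))
  traceable+x-b₁ = route⇒hamPath
    (in₃ (O₃.hamWalkTo c₃) ⟨ c₃-b₁ ⟩ʳ at₁ b₁ ⟨ new⁻ ⟩ʳ apex ⟨ x-a₁ ⟩ʳ in₁ O₁.avoidB ⟨ c₁-b₂ ⟩ʳ
     in₂ (O₂.hamWalkFrom b₂))
    apex-once (eachOnce⁺ O₁.avoidB) (eachOnce⁺ (O₂.hamWalkFrom b₂)) (eachOnce⁺ (O₃.hamWalkTo c₃))
    where open WithEdge xv (v₁ b₁)

  traceable+x-c₁ : Traceable (addEdge G xv (v₁ c₁))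
  traceable+x-c₁ = route⇒hamPath
    (in₂ (O₂.hamWalkTo b₂) ⟨ b₂-c₁ ⟩ʳ at₁ c₁ ⟨ new⁻ ⟩ʳ apex ⟨ x-a₁ ⟩ʳ in₁ O₁.avoidC ⟨ b₁-c₃ ⟩ʳ
     in₃ (O₃.hamWalkFrom c₃))
    apex-once (eachOnce⁺ O₁.avoidC) (eachOnce⁺ (O₂.hamWalkTo b₂)) (eachOnce⁺ (O₃.hamWalkFrom c₃))
    where open WithEdge xv (v₁ c₁)

  traceable+x-v₁ : ∀ {p} → ¬ O₁.Exit p → Traceable (addEdge G xv (v₁ p))
  traceable+x-v₁ {p} ¬exit = assemble (O₁.nonExitWalk-b′c′ ¬exit)
    where
    open WithEdge xv (v₁ p)
    assemble : Σ (Fin (Rooted.m R₁)) (λ w → HamWalk O₁.F [] p w × (w ≡ b₁ ⊎ w ≡ c₁)) → Traceable G⁺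
    assemble (_ , W , inj₁ refl) = route⇒hamPath
      (at₃ a₃ ⟨ a₃-x ⟩ʳ apex ⟨ new ⟩ʳ in₁ W ⟨ b₁-c₃ ⟩ʳ in₃ O₃.avoidA⁻ ⟨ b₃-c₂ ⟩ʳ in₂ (O₂.hamWalkFrom c₂))
      apex-once (eachOnce⁺ W) (eachOnce⁺ (O₂.hamWalkFrom c₂)) (eachOnce⁺ O₃.avoidA⁻)
    assemble (_ , W , inj₂ refl) = route⇒hamPath
      (at₂ a₂ ⟨ a₂-x ⟩ʳ apex ⟨ new ⟩ʳ in₁ W ⟨ c₁-b₂ ⟩ʳ in₂ O₂.avoidA ⟨ c₂-b₃ ⟩ʳ in₃ (O₃.hamWalkFrom b₃))
      apex-once (eachOnce⁺ W) (eachOnce⁺ O₂.avoidA) (eachOnce⁺ (O₃.hamWalkFrom b₃))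

  traceable+x-F₁ : ∀ p → ¬ G xv (v₁ p) → Traceable (addEdge G xv (v₁ p))
  traceable+x-F₁ p ¬x-p with O₁.exit? p
  ... | no ¬exit = traceable+x-v₁ ¬exit
  ... | yes isA = ⊥-elim (¬x-p O₁.emb-a′)
  ... | yes isB = traceable+x-b₁
  ... | yes isC = traceable+x-c₁
  ... | yes (there (there (there ())))

  traceable+F₁-F₁ : ∀ p q → p ≢ q → ¬ G (v₁ p) (v₁ q) → Traceable (addEdge G (v₁ p) (v₁ q))
  traceable+F₁-F₁ p q p≢q ¬p-q = assemble (O₁.addedWalk p≢q ¬p-q)
    where
    open WithEdge (v₁ p) (v₁ q)
    in₁⁺ : ∀ {M s t} (W : HamWalk (addEdge O₁.F p q) M s t) → Route G⁺ (v₁ s) (v₁ t) [ F₁ , HamWalk.verts W ]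
    in₁⁺ W = piece F₁ (walk-map v₁ lift (HamWalk.walk W))
      where
      lift : ∀ {x y} → addEdge O₁.F p q x y → G⁺ (v₁ x) (v₁ y)
      lift (inj₁ r)                   = inj₁ r
      lift (inj₂ (inj₁ (refl , refl))) = new
      lift (inj₂ (inj₂ (refl , refl))) = new⁻
    assemble : O₁.ExitPair (HamWalk (addEdge O₁.F p q) []) → Traceable G⁺
    assemble (inj₁ W) = route⇒hamPath
      (at₂ a₂ ⟨ a₂-x ⟩ʳ apex ⟨ x-a₃ ⟩ʳ in₃ O₃.avoidB ⟨ c₃-b₁ ⟩ʳ in₁⁺ W ⟨ c₁-b₂ ⟩ʳ in₂ O₂.avoidA ⟨ c₂-b₃ ⟩ʳ at₃ b₃)
      apex-once (eachOnce⁺ W) (eachOnce⁺ O₂.avoidA) (eachOnceʳ O₃.avoidB)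
    assemble (inj₂ (inj₁ W)) = route⇒hamPath
      (in₂ (O₂.hamWalkTo a₂) ⟨ a₂-x ⟩ʳ apex ⟨ x-a₁ ⟩ʳ in₁⁺ W ⟨ b₁-c₃ ⟩ʳ in₃ (O₃.hamWalkFrom c₃))
      apex-once (eachOnce⁺ W) (eachOnce⁺ (O₂.hamWalkTo a₂)) (eachOnce⁺ (O₃.hamWalkFrom c₃))
    assemble (inj₂ (inj₂ W)) = route⇒hamPath
      (in₃ (O₃.hamWalkTo a₃) ⟨ a₃-x ⟩ʳ apex ⟨ x-a₁ ⟩ʳ in₁⁺ W ⟨ c₁-b₂ ⟩ʳ in₂ (O₂.hamWalkFrom b₂))
      apex-once (eachOnce⁺ W) (eachOnce⁺ (O₂.hamWalkFrom b₂)) (eachOnce⁺ (O₃.hamWalkTo a₃))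

  traceable+v₁-F₂ : ∀ {p} q → ¬ O₁.Exit p → Traceable (addEdge G (v₁ p) (v₂ q))
  traceable+v₁-F₂ {p} q ¬exit = route⇒hamPath
    (in₂ (O₂.hamWalkTo q) ⟨ new⁻ ⟩ʳ in₁ (O₁.nonExitWalk-a′ ¬exit) ⟨ a₁-x ⟩ʳ apex ⟨ x-a₃ ⟩ʳ in₃ (O₃.hamWalkFrom a₃))
    apex-once (eachOnce⁺ (O₁.nonExitWalk-a′ ¬exit)) (eachOnce⁺ (O₂.hamWalkTo q)) (eachOnce⁺ (O₃.hamWalkFrom a₃))
    where open WithEdge (v₁ p) (v₂ q)

  traceable+F₁-v₂ : ∀ p {q} → ¬ O₂.Exit q → Traceable (addEdge G (v₁ p) (v₂ q))
  traceable+F₁-v₂ p {q} ¬exit = route⇒hamPath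
    (in₁ (O₁.hamWalkTo p) ⟨ new ⟩ʳ in₂ (O₂.nonExitWalk-a′ ¬exit) ⟨ a₂-x ⟩ʳ apex ⟨ x-a₃ ⟩ʳ in₃ (O₃.hamWalkFrom a₃))
    apex-once (eachOnce⁺ (O₁.hamWalkTo p)) (eachOnce⁺ (O₂.nonExitWalk-a′ ¬exit)) (eachOnce⁺ (O₃.hamWalkFrom a₃))
    where open WithEdge (v₁ p) (v₂ q)

  traceable+a₁-F₂ : ∀ {q} → O₂.Exit q → Traceable (addEdge G (v₁ a₁) (v₂ q))
  traceable+a₁-F₂ isA = route⇒hamPath
    (at₁ c₁ ⟨ c₁-b₂ ⟩ʳ in₂ O₂.avoidA ⟨ c₂-b₃ ⟩ʳ in₃ O₃.avoidC⁻ ⟨ a₃-x ⟩ʳ apex ⟨ x-a₂ ⟩ʳ at₂ a₂ ⟨ new⁻ ⟩ʳ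
     in₁ O₁.avoidC ⟨ b₁-c₃ ⟩ʳ at₃ c₃)
    apex-once (eachOnce⁺ O₁.avoidC) (eachOnceʳ O₂.avoidA) (eachOnceʳ O₃.avoidC⁻)
    where open WithEdge (v₁ a₁) (v₂ a₂)
  traceable+a₁-F₂ isB = route⇒hamPath
    (at₁ a₁ ⟨ new ⟩ʳ at₂ b₂ ⟨ b₂-c₁ ⟩ʳ in₁ O₁.avoidA⁻ ⟨ b₁-c₃ ⟩ʳ in₃ O₃.avoidA⁻ ⟨ b₃-c₂ ⟩ʳ in₂ O₂.avoidB⁻ ⟨ a₂-x ⟩ʳ
     apex ⟨ x-a₃ ⟩ʳ at₃ a₃)
    apex-once (eachOnce⁺ O₁.avoidA⁻) (eachOnce⁺ O₂.avoidB⁻) (eachOnceʳ O₃.avoidA⁻)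
    where open WithEdge (v₁ a₁) (v₂ b₂)
  traceable+a₁-F₂ isC = route⇒hamPath
    (at₃ a₃ ⟨ a₃-x ⟩ʳ apex ⟨ x-a₂ ⟩ʳ in₂ O₂.avoidC ⟨ b₂-c₁ ⟩ʳ in₁ O₁.avoidB⁻ ⟨ new ⟩ʳ at₂ c₂ ⟨ c₂-b₃ ⟩ʳ
     in₃ O₃.avoidA ⟨ c₃-b₁ ⟩ʳ at₁ b₁)
    apex-once (eachOnceʳ O₁.avoidB⁻) (eachOnceʳ O₂.avoidC) (eachOnce⁺ O₃.avoidA)
    where open WithEdge (v₁ a₁) (v₂ c₂)
  traceable+a₁-F₂ (there (there (there ())))

  traceable+b₁-F₂ : ∀ {q} → O₂.Exit q → Traceable (addEdge G (v₁ b₁) (v₂ q))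
  traceable+b₁-F₂ isA = route⇒hamPath
    (at₁ b₁ ⟨ new ⟩ʳ at₂ a₂ ⟨ a₂-x ⟩ʳ apex ⟨ x-a₁ ⟩ʳ in₁ O₁.avoidB ⟨ c₁-b₂ ⟩ʳ in₂ O₂.avoidA ⟨ c₂-b₃ ⟩ʳ
     in₃ (O₃.hamWalkFrom b₃))
    apex-once (eachOnce⁺ O₁.avoidB) (eachOnce⁺ O₂.avoidA) (eachOnce⁺ (O₃.hamWalkFrom b₃))
    where open WithEdge (v₁ b₁) (v₂ a₂)
  traceable+b₁-F₂ isB = route⇒hamPath
    (at₁ c₁ ⟨ c₁-b₂ ⟩ʳ at₂ b₂ ⟨ new⁻ ⟩ʳ in₁ O₁.avoidC⁻ ⟨ a₁-x ⟩ʳ apex ⟨ x-a₂ ⟩ʳ in₂ O₂.avoidB ⟨ c₂-b₃ ⟩ʳ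
     in₃ (O₃.hamWalkFrom b₃))
    apex-once (eachOnce⁺ O₁.avoidC⁻) (eachOnce⁺ O₂.avoidB) (eachOnce⁺ (O₃.hamWalkFrom b₃))
    where open WithEdge (v₁ b₁) (v₂ b₂)
  traceable+b₁-F₂ isC = route⇒hamPath
    (at₁ c₁ ⟨ c₁-b₂ ⟩ʳ in₂ O₂.avoidC⁻ ⟨ a₂-x ⟩ʳ apex ⟨ x-a₁ ⟩ʳ in₁ O₁.avoidC ⟨ new ⟩ʳ at₂ c₂ ⟨ c₂-b₃ ⟩ʳ
     in₃ (O₃.hamWalkFrom b₃))
    apex-once (eachOnce⁺ O₁.avoidC) (eachOnceʳ O₂.avoidC⁻) (eachOnce⁺ (O₃.hamWalkFrom b₃))
    where open WithEdge (v₁ b₁) (v₂ c₂)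
  traceable+b₁-F₂ (there (there (there ())))

  traceable+c₁-F₂ : ∀ {q} → O₂.Exit q → ¬ G (v₁ c₁) (v₂ q) → Traceable (addEdge G (v₁ c₁) (v₂ q))
  traceable+c₁-F₂ isA _ = route⇒hamPath
    (in₂ O₂.avoidA⁻ ⟨ b₂-c₁ ⟩ʳ at₁ c₁ ⟨ new ⟩ʳ at₂ a₂ ⟨ a₂-x ⟩ʳ apex ⟨ x-a₁ ⟩ʳ in₁ O₁.avoidC ⟨ b₁-c₃ ⟩ʳ
     in₃ (O₃.hamWalkFrom c₃))
    apex-once (eachOnce⁺ O₁.avoidC) (eachOnceʳ O₂.avoidA⁻) (eachOnce⁺ (O₃.hamWalkFrom c₃))
    where open WithEdge (v₁ c₁) (v₂ a₂)
  traceable+c₁-F₂ isB ¬c₁-b₂ = ⊥-elim (¬c₁-b₂ (O₂.emb-b′ , O₁.emb-c′))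
  traceable+c₁-F₂ isC _ = route⇒hamPath
    (at₂ c₂ ⟨ new⁻ ⟩ʳ at₁ c₁ ⟨ c₁-b₂ ⟩ʳ in₂ O₂.avoidC⁻ ⟨ a₂-x ⟩ʳ apex ⟨ x-a₁ ⟩ʳ in₁ O₁.avoidC ⟨ b₁-c₃ ⟩ʳ
     in₃ (O₃.hamWalkFrom c₃))
    apex-once (eachOnce⁺ O₁.avoidC) (eachOnce⁺ O₂.avoidC⁻) (eachOnce⁺ (O₃.hamWalkFrom c₃))
    where open WithEdge (v₁ c₁) (v₂ c₂)
  traceable+c₁-F₂ (there (there (there ()))) _

  traceable+F₁-F₂ : ∀ p q → ¬ G (v₁ p) (v₂ q) → Traceable (addEdge G (v₁ p) (v₂ q))
  traceable+F₁-F₂ p q ¬p-q with O₁.exit? p | O₂.exit? q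
  ... | no ¬exit | _        = traceable+v₁-F₂ q ¬exit
  ... | yes _    | no ¬exit = traceable+F₁-v₂ p ¬exit
  ... | yes isA  | yes e    = traceable+a₁-F₂ e
  ... | yes isB  | yes e    = traceable+b₁-F₂ e
  ... | yes isC  | yes e    = traceable+c₁-F₂ e ¬p-q
  ... | yes (there (there (there ()))) | _

-- Nontraceability

linked-++⁻ˡ : ∀ {G : Graph V} xs {ys} → Linked G (xs ++ ys) → Linked G xs
linked-++⁻ˡ []           _       = []
linked-++⁻ˡ (x ∷ [])     _       = [-]
linked-++⁻ˡ (x ∷ y ∷ xs) (r ∷ l) = r ∷ linked-++⁻ˡ (y ∷ xs) l

linked-++⁻ʳ : ∀ {G : Graph V} xs {ys} → Linked G (xs ++ ys) → Linked G ys
linked-++⁻ʳ []       l = l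
linked-++⁻ʳ (x ∷ xs) l = linked-++⁻ʳ xs (tail l)
  where
  tail : ∀ {y ys} → Linked _ (y ∷ ys) → Linked _ ys
  tail [-]     = []
  tail (_ ∷ l) = l

module _ {R₁ R₂ R₃ : Rooted} where

  Outside : KV R₁ R₂ R₃ → Set
  Outside xv     = ⊤
  Outside (v₁ _) = ⊥
  Outside (v₂ _) = ⊤
  Outside (v₃ _) = ⊤

  data Side : KV R₁ R₂ R₃ → Set where
    inside  : ∀ p → Side (v₁ p)
    outside : ∀ {v} → Outside v → Side v

  side : ∀ v → Side v
  side xv     = outside tt
  side (v₁ p) = inside p
  side (v₂ _) = outside tt
  side (v₃ _) = outside tt

  outside-≢ : ∀ {v p} → Outside v → v₁ p ≢ v
  outside-≢ () refl

  outside-sym : ∀ {n x} → Outside n → K4 R₁ R₂ R₃ n (v₁ x) → K4 R₁ R₂ R₃ (v₁ x) n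
  outside-sym {xv}   _ r = r
  outside-sym {v₂ _} _ r = r
  outside-sym {v₃ _} _ r = r

  ∈-after-outside : ∀ {y Q p} → Outside y → v₁ p ∈ y ∷ Q → v₁ p ∈ Q
  ∈-after-outside oy (here eq) = ⊥-elim (outside-≢ oy eq)
  ∈-after-outside oy (there q) = q

module EndInF₁ (R₁ R₂ R₃ : Rooted) (g₁ : Good R₁) where
  open Opened R₁ g₁ using (F; Exit; ≡a′; ≡b′; ≡c′; a≢b; a≢c; b≢c; no-four-exits; closeUp; nonHamiltonian)

  private
    Vertex : Set
    Vertex = KV R₁ R₂ R₃

    G : Graph Vertex
    G = K4 R₁ R₂ R₃

  outside-edge-exit : ∀ {x n} → Outside n → G (v₁ x) n → Exit x
  outside-edge-exit {n = xv}   _ x≡a       = here (≡a′ x≡a)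
  outside-edge-exit {n = v₂ _} _ (_ , x≡c) = there (there (here (≡c′ x≡c)))
  outside-edge-exit {n = v₃ _} _ (x≡b , _) = there (here (≡b′ x≡b))

  outside-neighbour-unique : ∀ {x n n′} → Outside n → Outside n′ → G (v₁ x) n → G (v₁ x) n′ → n ≡ n′
  outside-neighbour-unique {n = xv}   {xv}   _ _ _ _ = refl
  outside-neighbour-unique {n = xv}   {v₂ _} _ _ x≡a (_ , x≡c) = ⊥-elim (a≢c (trans (sym x≡a) x≡c))
  outside-neighbour-unique {n = xv}   {v₃ _} _ _ x≡a (x≡b , _) = ⊥-elim (a≢b (trans (sym x≡a) x≡b))
  outside-neighbour-unique {n = v₂ _} {xv}   _ _ (_ , x≡c) x≡a = ⊥-elim (a≢c (trans (sym x≡a) x≡c))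
  outside-neighbour-unique {n = v₂ _} {v₂ _} _ _ (q≡b , _) (q′≡b , _) =
    cong v₂ (punchIn-injective (Rooted.z R₂) _ _ (trans q≡b (sym q′≡b)))
  outside-neighbour-unique {n = v₂ _} {v₃ _} _ _ (_ , x≡c) (x≡b , _) = ⊥-elim (b≢c (trans (sym x≡b) x≡c))
  outside-neighbour-unique {n = v₃ _} {xv}   _ _ (x≡b , _) x≡a = ⊥-elim (a≢b (trans (sym x≡a) x≡b))
  outside-neighbour-unique {n = v₃ _} {v₂ _} _ _ (x≡b , _) (_ , x≡c) = ⊥-elim (b≢c (trans (sym x≡b) x≡c))
  outside-neighbour-unique {n = v₃ _} {v₃ _} _ _ (_ , q≡c) (_ , q′≡c) =
    cong v₃ (punchIn-injective (Rooted.z R₃) _ _ (trans q≡c (sym q′≡c)))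

  InF₁ : List Vertex → Set
  InF₁ L = Σ (Fin (Rooted.m R₁)) λ p → v₁ p ∈ L

  firstEntry : ∀ w L → Outside w → InF₁ L →
    Σ (List Vertex) λ P → Σ Vertex λ w′ → Σ (Fin (Rooted.m R₁)) λ e → Σ (List Vertex) λ M →
      (w ∷ L ≡ P ++ w′ ∷ v₁ e ∷ M) × Outside w′ × (∀ p → v₁ p ∉ P)
  firstEntry w [] _ (_ , ())
  firstEntry w (v ∷ L) ow (p , p∈) with side v | p∈
  ... | inside e  | _ = [] , w , e , L , refl , ow , λ _ ()
  ... | outside o | here eq = ⊥-elim (outside-≢ o eq)
  ... | outside o | there p∈L with firstEntry v L o (p , p∈L)
  ... | P , w′ , e , M , eq , ow′ , P-out =
    w ∷ P , w′ , e , M , cong (w ∷_) eq , ow′ , λ { p (here eq) → outside-≢ ow eq ; p (there p∈) → P-out p p∈ }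

  spanF₁ : ∀ M → Σ (List (Fin (Rooted.m R₁))) λ S → Σ (List Vertex) λ Rest →
    (M ≡ map v₁ S ++ Rest) × (Rest ≡ [] ⊎ Σ Vertex λ y → Σ (List Vertex) λ Q → Rest ≡ y ∷ Q × Outside y)
  spanF₁ [] = [] , [] , refl , inj₁ refl
  spanF₁ (v ∷ M) with side v
  ... | outside o = [] , v ∷ M , refl , inj₂ (v , M , refl , o)
  ... | inside p with spanF₁ M
  ... | S , Rest , eq , rest = p ∷ S , Rest , cong (v₁ p ∷_) eq , rest

  lastExit : ∀ y Q → Outside (lastOf y Q) → InF₁ (y ∷ Q) →
    Σ (Fin (Rooted.m R₁)) λ f → Σ Vertex λ n → Consec (v₁ f) n (y ∷ Q) × Outside n
  lastExit y [] ol (p , here refl) = ⊥-elim ol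
  lastExit y (y′ ∷ Q) ol (p , p∈) with side y | side y′ | p∈
  ... | inside f  | outside o′ | _ = f , y′ , here , o′
  ... | inside f  | inside f′  | _ with lastExit (v₁ f′) Q ol (f′ , here refl)
  ... | f″ , n , c , on = f″ , n , there c , on
  lastExit y (y′ ∷ Q) ol (p , p∈) | outside o | _ | here eq = ⊥-elim (outside-≢ o eq)
  lastExit y (y′ ∷ Q) ol (p , p∈) | outside o | _ | there p∈Q with lastExit y′ Q ol (p , p∈Q)
  ... | f , n , c , on = f , n , there c , on

  -- The path enters F₁ for the first time at e and runs through F₁ up to lastOf e S.
  pathWithRun : List Vertex → Vertex → Fin (Rooted.m R₁) → List (Fin (Rooted.m R₁)) → Vertex → List Vertex →
                List Vertex
  pathWithRun P w e S y Q = P ++ w ∷ (map v₁ (e ∷ S) ++ y ∷ Q)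

  module Run (P : List Vertex) (w : Vertex) (e : Fin (Rooted.m R₁)) (S : List (Fin (Rooted.m R₁)))
             (y : Vertex) (Q : List Vertex)
             (linked : Linked G (pathWithRun P w e S y Q)) (unique : Unique (pathWithRun P w e S y Q))
             (covers : ∀ v → v ∈ pathWithRun P w e S y Q)
             (ow : Outside w) (P-out : ∀ p → v₁ p ∉ P) (oy : Outside y) (olast : Outside (lastOf y Q)) where

    private
      L : List Vertex
      L = pathWithRun P w e S y Q

      run : List Vertex
      run = map v₁ (e ∷ S)

      t : Fin (Rooted.m R₁)
      t = lastOf e S

      unique-run-rest : Unique (run ++ y ∷ Q)
      unique-run-rest with unique-++⁻ P unique
      ... | _ , _ ∷ u , _ = u

      run-apart-rest : ∀ {v} → v ∈ run → v ∈ y ∷ Q → ⊥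
      run-apart-rest v∈run v∈rest = proj₂ (proj₂ (unique-++⁻ run unique-run-rest)) (v∈run , v∈rest)

      in-rest : ∀ {a b} → Consec a b (y ∷ Q) → Consec a b L
      in-rest c = consec-++ʳ P (there (consec-++ʳ run c))

      enter : Consec w (v₁ e) L
      enter = consec-++ʳ P here

      leave : Consec (v₁ t) y L
      leave = consec-++ʳ P (there (subst (λ v → Consec v y (run ++ y ∷ Q)) (lastOf-map v₁ e S)
                                         (consec-last (v₁ e) (map v₁ S) Q y)))

      t∈run : v₁ t ∈ run
      t∈run = subst (_∈ run) (lastOf-map v₁ e S) (lastOf-∈ (v₁ e) (map v₁ S))

      exit-entering : ∀ {n x} → Outside n → Consec n (v₁ x) L → Exit x
      exit-entering on c = outside-edge-exit on (outside-sym on (consec-linked linked c))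

      exit-leaving : ∀ {n x} → Outside n → Consec (v₁ x) n L → Exit x
      exit-leaving on c = outside-edge-exit on (consec-linked linked c)

    -- An F₁-vertex has only one outside neighbour, so the path cannot enter and leave F₁ through it.
    no-pass-through : ∀ {x n n′} → Consec n (v₁ x) L → Consec (v₁ x) n′ L → Outside n → Outside n′ → ⊥
    no-pass-through c c′ on on′
      with outside-neighbour-unique on on′ (outside-sym on (consec-linked linked c)) (consec-linked linked c′)
    ... | refl = consec-swap unique c c′

    e≢t : e ≢ t
    e≢t e≡t = no-pass-through enter (subst (λ x → Consec (v₁ x) y L) (sym e≡t) leave) ow oy

    -- A second visit to F₁ would use exit edges at four distinct exits.
    rest-outside : ∀ p → v₁ p ∉ y ∷ Q
    rest-outside p p∈
      with firstEntry y Q oy (p , ∈-after-outside oy p∈) | lastExit y Q olast (p , p∈)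
    ... | P′ , w′ , g , M , eq , ow′ , _ | f , n , cf , on = no-four-exits distinct
          (exit-entering ow enter) (exit-entering ow′ reenter) (exit-leaving oy leave) (exit-leaving on (in-rest cf))
      where
      reenter-rest : Consec w′ (v₁ g) (y ∷ Q)
      reenter-rest = subst (Consec w′ (v₁ g)) (sym eq) (consec-++ʳ P′ here)
      reenter : Consec w′ (v₁ g) L
      reenter = in-rest reenter-rest
      distinct : Unique (e ∷ g ∷ t ∷ f ∷ [])
      distinct =
        ((λ { refl → run-apart-rest (here refl) (consec-∈₂ reenter-rest) }) ∷
         e≢t ∷
         (λ { refl → no-pass-through enter (in-rest cf) ow on }) ∷ []) ∷
        ((λ { refl → no-pass-through reenter leave ow′ oy }) ∷
         (λ { refl → no-pass-through reenter (in-rest cf) ow′ on }) ∷ []) ∷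
        ((λ { refl → run-apart-rest t∈run (consec-∈₁ cf) }) ∷ []) ∷ [] ∷ []

    run-hamWalk : HamWalk F [] e t
    run-hamWalk = record
      { verts = e ∷ S
      ; walk = linked⇒walk (Linked.map⁻ (linked-++⁻ˡ run (linked-++⁻ʳ (w ∷ []) (linked-++⁻ʳ P linked))))
      ; eachOnce = unique-map⁻ (proj₁ (unique-++⁻ run unique-run-rest)) , in-run }
      where
      in-run : ∀ p → p ∈ e ∷ S
      in-run p with ∈-++⁻ P (covers (v₁ p))
      ... | inj₁ p∈P = ⊥-elim (P-out p p∈P)
      ... | inj₂ (here eq) = ⊥-elim (outside-≢ ow eq)
      ... | inj₂ (there p∈) with ∈-++⁻ run p∈
      ... | inj₂ p∈rest = ⊥-elim (rest-outside p p∈rest)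
      ... | inj₁ p∈run with ∈-map⁻ v₁ p∈run
      ... | _ , q∈ , refl = q∈

    impossible : ⊥
    impossible = nonHamiltonian (closeUp run-hamWalk e≢t (exit-entering ow enter) (exit-leaving oy leave))

  lastOf-≡ : ∀ (h : Vertex) L A b B → h ∷ L ≡ A ++ b ∷ B → lastOf h L ≡ lastOf b B
  lastOf-≡ h L []      b B refl = refl
  lastOf-≡ h L (x ∷ A) b B refl = lastOf-++ x A b B

  end-in-F₁ : ∀ h L → Linked G (h ∷ L) → EachOnce (h ∷ L) → Outside h → Outside (lastOf h L) → ⊥
  end-in-F₁ h L linked (unique , covers) oh olast
    with firstEntry h L oh (Opened.a′ R₁ g₁ , ∈-after-outside oh (covers (v₁ (Opened.a′ R₁ g₁))))
  ... | P , w , e , M , eq , ow , P-out with spanF₁ M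
  ... | S , _ , refl , inj₁ refl =
    subst Outside (trans (lastOf-≡ h L P w (v₁ e ∷ map v₁ S ++ []) eq)
                         (trans (cong (lastOf (v₁ e)) (++-identityʳ (map v₁ S))) (lastOf-map v₁ e S))) olast
  ... | S , _ , refl , inj₂ (y , Q , refl , oy) =
    Run.impossible P w e S y Q (subst (Linked G) eq linked) (subst Unique eq unique)
      (λ v → subst (v ∈_) eq (covers v)) ow P-out oy
      (subst Outside (trans (lastOf-≡ h L P w (v₁ e ∷ map v₁ S ++ y ∷ Q) eq) (lastOf-++ (v₁ e) (map v₁ S) y Q))
             olast)

-- Cubicity

CubicAt : Graph V → V → Set
CubicAt {V} G v = Σ V λ x → Σ V λ y → Σ V λ z →
  (x ≢ y × x ≢ z × y ≢ z) × (G v x × G v y × G v z) × (∀ w → G v w → w ≡ x ⊎ (w ≡ y ⊎ w ≡ z))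

cubicAt-transfer : ∀ {G : Graph V} {G′ : Graph W} {u v} (_∼_ : V → W → Set) →
  (∀ x → G u x → Σ W λ y → x ∼ y × G′ v y) → (∀ y → G′ v y → Σ V λ x → G u x × x ∼ y) →
  (∀ {x x′ y} → x ∼ y → x′ ∼ y → x ≡ x′) → (∀ {x y y′} → x ∼ y → x ∼ y′ → y ≡ y′) →
  CubicAt G u → CubicAt G′ v
cubicAt-transfer _∼_ forth back ∼-injective ∼-functional (x , y , z , (x≢y , x≢z , y≢z) , (ux , uy , uz) , only)
  with forth x ux | forth y uy | forth z uz
... | x′ , x∼ , vx | y′ , y∼ , vy | z′ , z∼ , vz =
  x′ , y′ , z′ ,
  ((λ { refl → x≢y (∼-injective x∼ y∼) }) , (λ { refl → x≢z (∼-injective x∼ z∼) }) ,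
   (λ { refl → y≢z (∼-injective y∼ z∼) })) ,
  (vx , vy , vz) , only′
  where
  only′ : ∀ w′ → _ → w′ ≡ x′ ⊎ (w′ ≡ y′ ⊎ w′ ≡ z′)
  only′ w′ vw′ with back w′ vw′
  ... | w , uw , w∼ with only w uw
  ... | inj₁ refl        = inj₁ (∼-functional w∼ x∼)
  ... | inj₂ (inj₁ refl) = inj₂ (inj₁ (∼-functional w∼ y∼))
  ... | inj₂ (inj₂ refl) = inj₂ (inj₂ (∼-functional w∼ z∼))

module Cubicity (R₁ R₂ R₃ : Rooted) (g₁ : Good R₁) (g₂ : Good R₂) (g₃ : Good R₃) where
  open EndInF₁ R₁ R₂ R₃ g₁ using (outside-edge-exit; outside-neighbour-unique)
  private
    module O₁ = Opened R₁ g₁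
    module O₂ = Opened R₂ g₂
    module O₃ = Opened R₃ g₃

    G : Graph (KV R₁ R₂ R₃)
    G = K4 R₁ R₂ R₃

  cubic-x : CubicAt G xv
  cubic-x = v₁ O₁.a′ , v₂ O₂.a′ , v₃ O₃.a′ , ((λ ()) , (λ ()) , (λ ())) , (O₁.emb-a′ , O₂.emb-a′ , O₃.emb-a′) , only
    where
    only : ∀ w → G xv w → w ≡ v₁ O₁.a′ ⊎ (w ≡ v₂ O₂.a′ ⊎ w ≡ v₃ O₃.a′)
    only (v₁ p) x-p = inj₁ (cong v₁ (O₁.≡a′ x-p))
    only (v₂ p) x-p = inj₂ (inj₁ (cong v₂ (O₂.≡a′ x-p)))
    only (v₃ p) x-p = inj₂ (inj₂ (cong v₃ (O₃.≡a′ x-p)))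

  -- The neighbour z of p in H₁ corresponds to the unique neighbour of p outside F₁.
  cubic-F₁ : ∀ p → CubicAt G (v₁ p)
  cubic-F₁ p = cubicAt-transfer {G = Rooted.H R₁} {G′ = G} {u = emb R₁ p} {v = v₁ p}
                 _∼_ forth back ∼-injective ∼-functional (O₁.H-cubic (emb R₁ p))
    where
    open Rooted R₁ using (H; z)
    _∼_ : Fin (suc (Rooted.m R₁)) → KV R₁ R₂ R₃ → Set
    w ∼ w′ = (w ≡ z × G (v₁ p) w′ × Outside w′) ⊎ (Σ (Fin (Rooted.m R₁)) λ q → emb R₁ q ≡ w × w′ ≡ v₁ q)

    outside-neighbour : O₁.Exit p → Σ (KV R₁ R₂ R₃) λ n → G (v₁ p) n × Outside n
    outside-neighbour isA = xv , O₁.emb-a′ , tt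
    outside-neighbour isB = v₃ O₃.c′ , (O₁.emb-b′ , O₃.emb-c′) , tt
    outside-neighbour isC = v₂ O₂.b′ , (O₂.emb-b′ , O₁.emb-c′) , tt
    outside-neighbour (there (there (there ())))

    forth : ∀ w → H (emb R₁ p) w → Σ (KV R₁ R₂ R₃) λ w′ → w ∼ w′ × G (v₁ p) w′
    forth w p-w with w ≟ z
    ... | yes refl with outside-neighbour (O₁.adjacent⇒exit (O₁.H-sym p-w))
    ...   | n , p-n , on = n , inj₁ (refl , p-n , on) , p-n
    forth w p-w | no w≢z = v₁ (punchOut (λ z≡w → w≢z (sym z≡w))) ,
      inj₂ (_ , punchIn-punchOut _ , refl) , subst (H (emb R₁ p)) (sym (punchIn-punchOut _)) p-w

    p-z : ∀ {n} → Outside n → G (v₁ p) n → H (emb R₁ p) z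
    p-z {n} on p-n = O₁.H-sym (O₁.exit⇒adjacent (outside-edge-exit {n = n} on p-n))

    back : ∀ w′ → G (v₁ p) w′ → Σ (Fin (suc (Rooted.m R₁))) λ w → H (emb R₁ p) w × w ∼ w′
    back (v₁ q) p-q = emb R₁ q , p-q , inj₂ (q , refl , refl)
    back xv     p-n = z , p-z {xv} tt p-n , inj₁ (refl , p-n , tt)
    back (v₂ q) p-n = z , p-z {v₂ q} tt p-n , inj₁ (refl , p-n , tt)
    back (v₃ q) p-n = z , p-z {v₃ q} tt p-n , inj₁ (refl , p-n , tt)

    ∼-injective : ∀ {w w₂ w′} → w ∼ w′ → w₂ ∼ w′ → w ≡ w₂
    ∼-injective (inj₁ (w≡z , _)) (inj₁ (w₂≡z , _)) = trans w≡z (sym w₂≡z)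
    ∼-injective (inj₁ (_ , _ , ()))  (inj₂ (_ , _ , refl))
    ∼-injective (inj₂ (_ , _ , refl)) (inj₁ (_ , _ , ()))
    ∼-injective (inj₂ (_ , e₁ , refl)) (inj₂ (_ , e₂ , refl)) = trans (sym e₁) e₂

    ∼-functional : ∀ {w w′ w″} → w ∼ w′ → w ∼ w″ → w′ ≡ w″
    ∼-functional (inj₁ (_ , p-n , on)) (inj₁ (_ , p-n′ , on′)) = outside-neighbour-unique on on′ p-n p-n′
    ∼-functional (inj₁ (refl , _)) (inj₂ (q , q≡z , _)) = ⊥-elim (O₁.emb≢z q q≡z)
    ∼-functional (inj₂ (q , q≡z , _)) (inj₁ (refl , _)) = ⊥-elim (O₁.emb≢z q q≡z)
    ∼-functional (inj₂ (_ , e₁ , refl)) (inj₂ (_ , e₂ , refl)) = cong v₁ (O₁.emb-injective (trans e₁ (sym e₂)))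

-- Graph isomorphisms

record _≅_ {V W : Set} (G : Graph V) (G′ : Graph W) : Set where
  field
    to        : V → W
    from      : W → V
    from∘to   : ∀ v → from (to v) ≡ v
    to∘from   : ∀ w → to (from w) ≡ w
    to-edge   : ∀ {x y} → G x y → G′ (to x) (to y)
    from-edge : ∀ {x y} → G′ x y → G (from x) (from y)

  to-injective : ∀ {x y} → to x ≡ to y → x ≡ y
  to-injective {x} {y} eq = trans (sym (from∘to x)) (trans (cong from eq) (from∘to y))

  linked-to : ∀ {xs} → Linked G xs → Linked G′ (map to xs)
  linked-to l = Linked.map⁺ (Data.List.Relation.Unary.Linked.map {R = G} {S = λ x y → G′ (to x) (to y)} to-edge l)

  eachOnce-to : ∀ {xs} → EachOnce xs → EachOnce (map to xs)
  eachOnce-to (u , covers) =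
    unique-map⁺ to-injective u , λ w → subst (_∈ _) (to∘from w) (∈-map⁺ to (covers (from w)))

  traceable-to : Traceable G → Traceable G′
  traceable-to P = record
    { verts = map to verts ; linked = linked-to linked
    ; unique = proj₁ (eachOnce-to (unique , covers)) ; covers = proj₂ (eachOnce-to (unique , covers)) }
    where open HamPath P

  cubicAt-to : ∀ {v} → CubicAt G v → CubicAt G′ (to v)
  cubicAt-to {v} = cubicAt-transfer {G = G} {G′ = G′} {u = v} {v = to v} (λ x y → to x ≡ y)
    (λ x v-x → to x , refl , to-edge v-x)
    (λ y tv-y → from y , subst (λ u → G u (from y)) (from∘to v) (from-edge tv-y) , to∘from y)
    (λ { refl eq → to-injective (sym eq) }) (λ { refl refl → refl })

≅-sym : ∀ {G : Graph V} {G′ : Graph W} → G ≅ G′ → G′ ≅ G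
≅-sym i = record
  { to = from ; from = to ; from∘to = to∘from ; to∘from = from∘to
  ; to-edge = λ {x} {y} → from-edge {x} {y} ; from-edge = λ {x} {y} → to-edge {x} {y} }
  where open _≅_ i

addEdge-≅ : ∀ {G : Graph V} {G′ : Graph W} (i : G ≅ G′) u v → addEdge G u v ≅ addEdge G′ (_≅_.to i u) (_≅_.to i v)
addEdge-≅ {G = G} {G′} i u v = record
  { to = to ; from = from ; from∘to = from∘to ; to∘from = to∘from ; to-edge = to-edge′ ; from-edge = from-edge′ }
  where
  open _≅_ i
  to-edge′ : ∀ {x y} → addEdge G u v x y → addEdge G′ (to u) (to v) (to x) (to y)
  to-edge′ (inj₁ r)                    = inj₁ (to-edge r)
  to-edge′ (inj₂ (inj₁ (refl , refl))) = inj₂ (inj₁ (refl , refl))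
  to-edge′ (inj₂ (inj₂ (refl , refl))) = inj₂ (inj₂ (refl , refl))
  back : ∀ {x w} → x ≡ to w → from x ≡ w
  back refl = from∘to _
  from-edge′ : ∀ {x y} → addEdge G′ (to u) (to v) x y → addEdge G u v (from x) (from y)
  from-edge′ (inj₁ r)                    = inj₁ (from-edge r)
  from-edge′ (inj₂ (inj₁ (x≡ , y≡))) = inj₂ (inj₁ (back x≡ , back y≡))
  from-edge′ (inj₂ (inj₂ (x≡ , y≡))) = inj₂ (inj₂ (back x≡ , back y≡))

addEdge-swap : ∀ {G : Graph V} u v → addEdge G u v ≅ addEdge G v u
addEdge-swap u v = record
  { to = λ x → x ; from = λ x → x ; from∘to = λ _ → refl ; to∘from = λ _ → refl
  ; to-edge = Data.Sum.map (λ r → r) Data.Sum.swap ; from-edge = Data.Sum.map (λ r → r) Data.Sum.swap }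

module _ (R₁ R₂ R₃ : Rooted) where

  rotate-vertex : KV R₁ R₂ R₃ → KV R₂ R₃ R₁
  rotate-vertex xv     = xv
  rotate-vertex (v₁ p) = v₃ p
  rotate-vertex (v₂ p) = v₁ p
  rotate-vertex (v₃ p) = v₂ p

  unrotate-vertex : KV R₂ R₃ R₁ → KV R₁ R₂ R₃
  unrotate-vertex xv     = xv
  unrotate-vertex (v₁ p) = v₂ p
  unrotate-vertex (v₂ p) = v₃ p
  unrotate-vertex (v₃ p) = v₁ p

  rotation : K4 R₁ R₂ R₃ ≅ K4 R₂ R₃ R₁
  rotation = record
    { to = rotate-vertex ; from = unrotate-vertex ; from∘to = from∘to ; to∘from = to∘from
    ; to-edge = λ {x} {y} → to-edge x y ; from-edge = λ {x} {y} → from-edge x y }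
    where
    from∘to : ∀ v → unrotate-vertex (rotate-vertex v) ≡ v
    from∘to xv     = refl
    from∘to (v₁ _) = refl
    from∘to (v₂ _) = refl
    from∘to (v₃ _) = refl
    to∘from : ∀ v → rotate-vertex (unrotate-vertex v) ≡ v
    to∘from xv     = refl
    to∘from (v₁ _) = refl
    to∘from (v₂ _) = refl
    to∘from (v₃ _) = refl
    to-edge : ∀ x y → K4 R₁ R₂ R₃ x y → K4 R₂ R₃ R₁ (rotate-vertex x) (rotate-vertex y)
    to-edge xv     xv     ()
    to-edge xv     (v₁ _) r = r
    to-edge xv     (v₂ _) r = r
    to-edge xv     (v₃ _) r = r
    to-edge (v₁ _) xv     r = r
    to-edge (v₁ _) (v₁ _) r = r
    to-edge (v₁ _) (v₂ _) r = r
    to-edge (v₁ _) (v₃ _) r = r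
    to-edge (v₂ _) xv     r = r
    to-edge (v₂ _) (v₁ _) r = r
    to-edge (v₂ _) (v₂ _) r = r
    to-edge (v₂ _) (v₃ _) r = r
    to-edge (v₃ _) xv     r = r
    to-edge (v₃ _) (v₁ _) r = r
    to-edge (v₃ _) (v₂ _) r = r
    to-edge (v₃ _) (v₃ _) r = r
    from-edge : ∀ x y → K4 R₂ R₃ R₁ x y → K4 R₁ R₂ R₃ (unrotate-vertex x) (unrotate-vertex y)
    from-edge xv     xv     ()
    from-edge xv     (v₁ _) r = r
    from-edge xv     (v₂ _) r = r
    from-edge xv     (v₃ _) r = r
    from-edge (v₁ _) xv     r = r
    from-edge (v₁ _) (v₁ _) r = r
    from-edge (v₁ _) (v₂ _) r = r
    from-edge (v₁ _) (v₃ _) r = r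
    from-edge (v₂ _) xv     r = r
    from-edge (v₂ _) (v₁ _) r = r
    from-edge (v₂ _) (v₂ _) r = r
    from-edge (v₂ _) (v₃ _) r = r
    from-edge (v₃ _) xv     r = r
    from-edge (v₃ _) (v₁ _) r = r
    from-edge (v₃ _) (v₂ _) r = r
    from-edge (v₃ _) (v₃ _) r = r

module _ (R₁ R₂ R₃ : Rooted) (g₁ : Good R₁) (g₂ : Good R₂) (g₃ : Good R₃) where
  private
    G : Graph (KV R₁ R₂ R₃)
    G = K4 R₁ R₂ R₃

    ρ : K4 R₁ R₂ R₃ ≅ K4 R₂ R₃ R₁
    ρ = rotation R₁ R₂ R₃

    σ : K4 R₁ R₂ R₃ ≅ K4 R₃ R₁ R₂
    σ = ≅-sym (rotation R₃ R₁ R₂)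

    module M₁ = Maximality R₁ R₂ R₃ g₁ g₂ g₃
    module M₂ = Maximality R₂ R₃ R₁ g₂ g₃ g₁
    module M₃ = Maximality R₃ R₁ R₂ g₃ g₁ g₂

    via : ∀ {G′ : Graph W} (i : G′ ≅ G) {u v} → Traceable (addEdge G′ u v) →
          Traceable (addEdge G (_≅_.to i u) (_≅_.to i v))
    via i {u} {v} = _≅_.traceable-to (addEdge-≅ i u v)

    swapped : ∀ u v → Traceable (addEdge G v u) → Traceable (addEdge G u v)
    swapped u v = _≅_.traceable-to (addEdge-swap v u)

  k4-cubic : Cubic G
  k4-cubic xv     = Cubicity.cubic-x R₁ R₂ R₃ g₁ g₂ g₃
  k4-cubic (v₁ p) = Cubicity.cubic-F₁ R₁ R₂ R₃ g₁ g₂ g₃ p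
  k4-cubic (v₂ p) = _≅_.cubicAt-to (≅-sym ρ) {v₁ p} (Cubicity.cubic-F₁ R₂ R₃ R₁ g₂ g₃ g₁ p)
  k4-cubic (v₃ p) = _≅_.cubicAt-to (≅-sym σ) {v₁ p} (Cubicity.cubic-F₁ R₃ R₁ R₂ g₃ g₁ g₂ p)

  ends-miss-a-part : ∀ h l → (Outside h × Outside l) ⊎ (Outside (_≅_.to ρ h) × Outside (_≅_.to ρ l)) ⊎
                                                         (Outside (_≅_.to σ h) × Outside (_≅_.to σ l))
  ends-miss-a-part h l with side h | side l
  ... | outside oh | outside ol = inj₁ (oh , ol)
  ... | inside _   | inside _   = inj₂ (inj₁ (tt , tt))
  ends-miss-a-part h (v₁ _) | outside _ | _ with h
  ... | xv   = inj₂ (inj₁ (tt , tt))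
  ... | v₂ _ = inj₂ (inj₂ (tt , tt))
  ... | v₃ _ = inj₂ (inj₁ (tt , tt))
  ends-miss-a-part (v₁ _) l | _ | outside _ with l
  ... | xv   = inj₂ (inj₁ (tt , tt))
  ... | v₂ _ = inj₂ (inj₂ (tt , tt))
  ... | v₃ _ = inj₂ (inj₁ (tt , tt))

  k4-nontraceable : ¬ Traceable G
  k4-nontraceable P = no-path (HamPath.verts P) (HamPath.linked P) (HamPath.unique P , HamPath.covers P)
    where
    no-path : ∀ L → Linked G L → EachOnce L → ⊥
    no-path [] _ (_ , covers) with covers xv
    ... | ()
    no-path (h ∷ L) linked once with ends-miss-a-part h (lastOf h L)
    ... | inj₁ (oh , ol) = EndInF₁.end-in-F₁ R₁ R₂ R₃ g₁ h L linked once oh ol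
    ... | inj₂ (inj₁ (oh , ol)) =
      EndInF₁.end-in-F₁ R₂ R₃ R₁ g₂ _ _ (_≅_.linked-to ρ linked) (_≅_.eachOnce-to ρ once) oh
        (subst Outside (sym (lastOf-map (_≅_.to ρ) h L)) ol)
    ... | inj₂ (inj₂ (oh , ol)) =
      EndInF₁.end-in-F₁ R₃ R₁ R₂ g₃ _ _ (_≅_.linked-to σ linked) (_≅_.eachOnce-to σ once) oh
        (subst Outside (sym (lastOf-map (_≅_.to σ) h L)) ol)

  k4-maximal : ∀ u v → u ≢ v → ¬ G u v → Traceable (addEdge G u v)
  k4-maximal xv     xv     u≢v _  = ⊥-elim (u≢v refl)
  k4-maximal xv     (v₁ p) _   ¬e = M₁.traceable+x-F₁ p ¬e
  k4-maximal xv     (v₂ p) _   ¬e = via (≅-sym ρ) (M₂.traceable+x-F₁ p ¬e)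
  k4-maximal xv     (v₃ p) _   ¬e = via (≅-sym σ) (M₃.traceable+x-F₁ p ¬e)
  k4-maximal (v₁ p) (v₁ q) u≢v ¬e = M₁.traceable+F₁-F₁ p q (λ p≡q → u≢v (cong v₁ p≡q)) ¬e
  k4-maximal (v₂ p) (v₂ q) u≢v ¬e = via (≅-sym ρ) (M₂.traceable+F₁-F₁ p q (λ p≡q → u≢v (cong v₂ p≡q)) ¬e)
  k4-maximal (v₃ p) (v₃ q) u≢v ¬e = via (≅-sym σ) (M₃.traceable+F₁-F₁ p q (λ p≡q → u≢v (cong v₃ p≡q)) ¬e)
  k4-maximal (v₁ p) (v₂ q) _   ¬e = M₁.traceable+F₁-F₂ p q ¬e
  k4-maximal (v₂ p) (v₃ q) _   ¬e = via (≅-sym ρ) (M₂.traceable+F₁-F₂ p q ¬e)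
  k4-maximal (v₃ p) (v₁ q) _   ¬e = via (≅-sym σ) (M₃.traceable+F₁-F₂ p q ¬e)
  k4-maximal u@(v₁ _) xv     u≢v ¬e = swapped u xv (k4-maximal xv u (λ e → u≢v (sym e)) ¬e)
  k4-maximal u@(v₂ _) xv     u≢v ¬e = swapped u xv (k4-maximal xv u (λ e → u≢v (sym e)) ¬e)
  k4-maximal u@(v₃ _) xv     u≢v ¬e = swapped u xv (k4-maximal xv u (λ e → u≢v (sym e)) ¬e)
  k4-maximal u@(v₂ _) v@(v₁ _) u≢v ¬e = swapped u v (k4-maximal v u (λ e → u≢v (sym e)) ¬e)
  k4-maximal u@(v₃ _) v@(v₂ _) u≢v ¬e = swapped u v (k4-maximal v u (λ e → u≢v (sym e)) ¬e)
  k4-maximal u@(v₁ _) v@(v₃ _) u≢v ¬e = swapped u v (k4-maximal v u (λ e → u≢v (sym e)) ¬e)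

theorem9 : (R₁ R₂ R₃ : Rooted) → Good R₁ → Good R₂ → Good R₃ →
    Cubic (K4 R₁ R₂ R₃) × MaxNontraceable (K4 R₁ R₂ R₃)
theorem9 R₁ R₂ R₃ g₁ g₂ g₃ =
  k4-cubic R₁ R₂ R₃ g₁ g₂ g₃ , k4-nontraceable R₁ R₂ R₃ g₁ g₂ g₃ , k4-maximal R₁ R₂ R₃ g₁ g₂ g₃
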